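{- For $n\ge0$, $$d(n+1,i,j)=d(n,i,j)+2i\,d(n,i,j-1)+2j\,d(n,i-1,j)+4(n-i-j+2)\,d(n,i-1,j-1),$$ with initial conditions $d(1,0,0)=1$ and $d(1,i,j)=0$ for $i\ne0$ or $j\ne0$.
   Context: $B_n$ is the group of signed permutations $\pi$ of $\pm[n]$ with $\pi(-i)=-\pi(i)$; $\mathcal{D}_n^B$ is the set of $\pi\in B_n$ with no $i\in[n]$ satisfying $\pi(i)=i$ ($\mathcal{D}_0^B$ consists of the empty signed permutation). For $\pi\in\mathcal{D}_n^B$: $\mathrm{wexc}(\pi)=\#\{i\in[n]:\pi(|\pi(i)|)>\pi(i)\}$ and $\mathrm{aexc}(\pi)=\#\{i\in[n]:\pi(|\pi(i)|)<\pi(i)\}$. $d(n,i,j)$ is the number of $\pi\in\mathcal{D}_n^B$ with $\mathrm{wexc}(\pi)=i$ and $\mathrm{aexc}(\pi)=j$; in particular $d(0,0,0)=1$, and $d(n,i,j)=0$ whenever $i<0$ or $j<0$. -}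

module Defs where

open import Data.Bool using (Bool; true; false; _∧_; not; if_then_else_)
open import Data.Nat as ℕ using (ℕ; zero; suc)
open import Data.Integer as ℤ using (ℤ; +_; -[1+_]; ∣_∣; -_)
import Data.Integer.Properties as ℤP
import Data.Nat.Properties as ℕP
open import Data.List using (List; []; _∷_; map; concatMap; filter; length; upTo; _++_)
open import Relation.Nullary using (does)

-- A signed permutation π ∈ B_n is represented by its window
-- [π(1), …, π(n)] : List ℤ (π(-i) = -π(i) determines the rest).

pm : ℕ → List ℤ
pm n = map (λ k → + suc k) (upTo n) ++ map (λ k → - (+ suc k)) (upTo n)

words : {A : Set} → ℕ → List A → List (List A)
words zero    xs = [] ∷ []
words (suc n) xs = concatMap (λ x → map (x ∷_) (words n xs)) xs

elemℕ : ℕ → List ℕ → Bool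
elemℕ k []       = false
elemℕ k (m ∷ ms) = does (k ℕ.≟ m) Data.Bool.∨ elemℕ k ms

distinct : List ℕ → Bool
distinct []       = true
distinct (m ∷ ms) = not (elemℕ m ms) ∧ distinct ms

-- a window is a signed permutation iff its absolute values are distinct
-- (entries are drawn from ±[n], so |π(1)|,…,|π(n)| is then a permutation of [n])
isSignedPerm : List ℤ → Bool
isSignedPerm w = distinct (map ∣_∣ w)

Bn : ℕ → List (List ℤ)
Bn n = filter (λ w → Data.Bool.T? (isSignedPerm w)) (words n (pm n))

-- π(k) for k ∈ [n] (1-indexed); default 0 outside range (never used)
at : List ℤ → ℕ → ℤ
at []       _             = + 0
at (x ∷ xs) zero          = + 0
at (x ∷ xs) (suc zero)    = x
at (x ∷ xs) (suc (suc k)) = at xs (suc k)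

noFixedAux : ℕ → List ℤ → Bool
noFixedAux i []       = true
noFixedAux i (x ∷ xs) = not (does (x ℤP.≟ + i)) ∧ noFixedAux (suc i) xs

isDerangement : List ℤ → Bool
isDerangement w = noFixedAux 1 w

DBn : ℕ → List (List ℤ)
DBn n = filter (λ w → Data.Bool.T? (isDerangement w)) (Bn n)

count : {A : Set} → (A → Bool) → List A → ℕ
count p []       = 0
count p (x ∷ xs) = (if p x then 1 else 0) ℕ.+ count p xs

-- wexc(π) = #{i ∈ [n] : π(|π(i)|) > π(i)}
wexc : List ℤ → ℕ
wexc w = count (λ x → does (x ℤP.<? at w ∣ x ∣)) w

-- aexc(π) = #{i ∈ [n] : π(|π(i)|) < π(i)}
aexc : List ℤ → ℕ
aexc w = count (λ x → does (at w ∣ x ∣ ℤP.<? x)) w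

dℕ : ℕ → ℕ → ℕ → ℕ
dℕ n i j = count (λ w → does (wexc w ℕ.≟ i) ∧ does (aexc w ℕ.≟ j)) (DBn n)

-- d(n,i,j) with integer indices, = 0 whenever i < 0 or j < 0
d : ℕ → ℤ → ℤ → ℤ
d n (+ i) (+ j) = + dℕ n i j
d n _     _     = + 0

-- Every π ∈ D_{n+1}^B arises exactly once from some σ ∈ D_n^B: either π(n+1) = −(n+1) is appended,
-- or, for an entry x of σ and k = |x|, the entry ±(n+1) is put at position k and σ(k) moves to the
-- end as π(n+1) = ±σ(k), its sign being free only when σ(k) = x (that is, σ(k) = −k).
-- Appending keeps (wexc, aexc).  Displacing x replaces the comparison of x with σ(|x|) by two
-- comparisons against ±(n+1), which together give one weak and one anti excedance, while every other
-- entry keeps its comparison.  So σ with statistics (W, A) and F = n − W − A entries with σ(|x|) = x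
-- has one extension with statistics (W, A), 2W with (W, A+1), 2A with (W+1, A) and 4F with
-- (W+1, A+1); summing over D_n^B gives the recurrence.

module Submission where

open import Data.Bool using (Bool; true; false; T; not; _∧_; if_then_else_)
open import Data.Bool.Properties using (T-∧; T-∨; ∧-assoc; ∧-zeroʳ)
open import Data.Empty using (⊥-elim)
open import Data.Integer as ℤ using (ℤ; +_; -[1+_]; ∣_∣; -_; _+_; _-_; _*_)
import Data.Integer.Properties as ℤP
open import Data.Integer.Tactic.RingSolver using (solve-∀)
open import Data.Nat as ℕ using (ℕ; zero; suc; s≤s; z≤n)
import Data.Nat.Properties as ℕP
import Data.Nat.Tactic.RingSolver as ℕ-Solver
open import Data.List using (List; []; _∷_; _++_; _∷ʳ_; [_]; map; concatMap; length; upTo; initLast; _∷ʳ′_)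
open import Data.List.Properties
  using (∷-injective; ∷ʳ-injective; ∷ʳ-injectiveˡ; ∷ʳ-injectiveʳ; length-map; length-++-sucʳ; length-++-≤ˡ; length-upTo)
open import Data.List.Membership.DecPropositional ℕ._≟_ using (_∈?_)
open import Data.List.Membership.Propositional using (_∈_; _∉_; find; lose)
open import Data.List.Membership.Propositional.Properties
  using (∈-map⁺; ∈-map⁻; ∈-++⁺ˡ; ∈-++⁺ʳ; ∈-++⁻; ∈-∃++; ∈-upTo⁺; ∈-upTo⁻; ∈-filter⁺; ∈-filter⁻;
         ∈-concatMap⁺; ∈-concatMap⁻)
open import Data.List.Membership.Propositional.Properties.WithK using (unique∧set⇒bag)
open import Data.List.Relation.Binary.BagAndSetEquality using (∼bag⇒↭)
open import Data.List.Relation.Binary.Permutation.Propositional using (_↭_; refl; prep; swap; trans; ↭-sym; ↭⇒↭ₛ)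
open import Data.List.Relation.Binary.Permutation.Propositional.Properties as PermProp
  using (shift; ∷↭∷ʳ; ↭-length; All-resp-↭)
import Data.List.Relation.Binary.Permutation.Setoid.Properties as PermSetoid
open import Data.List.Relation.Unary.All as All using (All; []; _∷_)
import Data.List.Relation.Unary.All.Properties as AllP
open import Data.List.Relation.Unary.AllPairs as AllPairs using ([]; _∷_)
open import Data.List.Relation.Unary.Any using (here; there)
open import Data.List.Relation.Unary.Unique.Propositional using (Unique)
import Data.List.Relation.Unary.Unique.Propositional.Properties as Unique
open import Data.Product as Product using (_×_; _,_; proj₁; proj₂; ∃)
open import Data.Sum using (_⊎_; inj₁; inj₂)
open import Function using (_∘_; _⇔_; mk⇔; Equivalence)
open import Relation.Binary.PropositionalEquality as ≡ using (_≡_; _≢_; refl; cong; cong₂; sym; subst)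
open import Relation.Nullary using (¬_; Dec; yes; no; does)
open import Relation.Nullary.Decidable using (dec-true; dec-false; T?)
open import Defs

bit : Bool → ℕ
bit b = if b then 1 else 0

∑ : {A : Set} → List A → (A → ℤ) → ℤ
∑ []       f = + 0
∑ (x ∷ xs) f = f x + ∑ xs f

syntax ∑ xs (λ x → e) = ∑[ x ∈ xs ] e

module _ {A : Set} where

  ∑-cong : ∀ xs {f g : A → ℤ} → (∀ {x} → x ∈ xs → f x ≡ g x) → ∑ xs f ≡ ∑ xs g
  ∑-cong []       eq = refl
  ∑-cong (x ∷ xs) eq = cong₂ _+_ (eq (here refl)) (∑-cong xs (eq ∘ there))

  ∑-const : ∀ (xs : List A) c → ∑[ _ ∈ xs ] c ≡ + length xs * c
  ∑-const []       c = sym (ℤP.*-zeroˡ c)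
  ∑-const (x ∷ xs) c = ≡.trans (cong (λ s → c + s) (∑-const xs c)) (lemma (+ length xs) c)
    where
    lemma : ∀ l c → c + l * c ≡ (+ 1 + l) * c
    lemma = solve-∀

  ∑-zero : ∀ (xs : List A) → ∑[ _ ∈ xs ] (+ 0) ≡ + 0
  ∑-zero []       = refl
  ∑-zero (x ∷ xs) = ≡.trans (ℤP.+-identityˡ _) (∑-zero xs)

  ∑-+ : ∀ xs (f g : A → ℤ) → ∑[ x ∈ xs ] (f x + g x) ≡ ∑ xs f + ∑ xs g
  ∑-+ []       f g = refl
  ∑-+ (x ∷ xs) f g = ≡.trans (cong (λ s → f x + g x + s) (∑-+ xs f g)) (lemma (f x) (g x) (∑ xs f) (∑ xs g))
    where
    lemma : ∀ a b c d → a + b + (c + d) ≡ a + c + (b + d)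
    lemma = solve-∀

  ∑-*ˡ : ∀ xs c (f : A → ℤ) → ∑[ x ∈ xs ] (c * f x) ≡ c * ∑ xs f
  ∑-*ˡ []       c f = sym (ℤP.*-zeroʳ c)
  ∑-*ˡ (x ∷ xs) c f = ≡.trans (cong (λ s → c * f x + s) (∑-*ˡ xs c f)) (sym (ℤP.*-distribˡ-+ c (f x) (∑ xs f)))

  ∑-++ : ∀ xs ys (f : A → ℤ) → ∑ (xs ++ ys) f ≡ ∑ xs f + ∑ ys f
  ∑-++ []       ys f = sym (ℤP.+-identityˡ (∑ ys f))
  ∑-++ (x ∷ xs) ys f = ≡.trans (cong (λ s → f x + s) (∑-++ xs ys f)) (sym (ℤP.+-assoc (f x) (∑ xs f) (∑ ys f)))

  ∑-map : ∀ {B : Set} (g : B → A) xs (f : A → ℤ) → ∑ (map g xs) f ≡ ∑ xs (f ∘ g)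
  ∑-map g []       f = refl
  ∑-map g (x ∷ xs) f = cong (λ s → f (g x) + s) (∑-map g xs f)

  ∑-concatMap : ∀ {B : Set} (g : B → List A) xs (f : A → ℤ) → ∑ (concatMap g xs) f ≡ ∑[ x ∈ xs ] ∑ (g x) f
  ∑-concatMap g []       f = refl
  ∑-concatMap g (x ∷ xs) f =
    ≡.trans (∑-++ (g x) (concatMap g xs) f) (cong (λ s → ∑ (g x) f + s) (∑-concatMap g xs f))

  ∑-↭ : ∀ {xs ys} (f : A → ℤ) → xs ↭ ys → ∑ xs f ≡ ∑ ys f
  ∑-↭ f refl                    = refl
  ∑-↭ f (prep x p)              = cong (λ s → f x + s) (∑-↭ f p)
  ∑-↭ f (swap {xs} {ys} x y p)  = ≡.trans (cong (λ s → f x + (f y + s)) (∑-↭ f p)) (lemma (f x) (f y) (∑ ys f))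
    where
    lemma : ∀ a b c → a + (b + c) ≡ b + (a + c)
    lemma = solve-∀
  ∑-↭ f (trans p q)             = ≡.trans (∑-↭ f p) (∑-↭ f q)

  count-as-∑ : ∀ (p : A → Bool) xs → + count p xs ≡ ∑[ x ∈ xs ] (+ bit (p x))
  count-as-∑ p []       = refl
  count-as-∑ p (x ∷ xs) =
    ≡.trans (ℤP.pos-+ (bit (p x)) (count p xs)) (cong (λ s → + bit (p x) + s) (count-as-∑ p xs))

  ∑-linear₄ : ∀ xs (f₀ : A → ℤ) c₁ f₁ c₂ f₂ c₃ f₃ →
              ∑[ x ∈ xs ] (f₀ x + c₁ * f₁ x + c₂ * f₂ x + c₃ * f₃ x) ≡
              ∑ xs f₀ + c₁ * ∑ xs f₁ + c₂ * ∑ xs f₂ + c₃ * ∑ xs f₃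
  ∑-linear₄ xs f₀ c₁ f₁ c₂ f₂ c₃ f₃ =
    ≡.trans (∑-+-*ˡ (λ x → f₀ x + c₁ * f₁ x + c₂ * f₂ x) c₃ f₃)
      (cong (_+ c₃ * ∑ xs f₃) (≡.trans (∑-+-*ˡ (λ x → f₀ x + c₁ * f₁ x) c₂ f₂)
        (cong (_+ c₂ * ∑ xs f₂) (∑-+-*ˡ f₀ c₁ f₁))))
    where
    ∑-+-*ˡ : ∀ (f : A → ℤ) c g → ∑[ x ∈ xs ] (f x + c * g x) ≡ ∑ xs f + c * ∑ xs g
    ∑-+-*ˡ f c g = ≡.trans (∑-+ xs f (λ x → c * g x)) (cong (λ s → ∑ xs f + s) (∑-*ˡ xs c g))

  ∑-count : ∀ (p : A → Bool) xs K → ∑[ x ∈ xs ] (+ bit (p x) * K) ≡ + count p xs * K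
  ∑-count p []       K = sym (ℤP.*-zeroˡ K)
  ∑-count p (x ∷ xs) K = begin
    + bit (p x) * K + ∑[ x ∈ xs ] (+ bit (p x) * K) ≡⟨ cong (λ s → + bit (p x) * K + s) (∑-count p xs K) ⟩
    + bit (p x) * K + + count p xs * K             ≡⟨ ℤP.*-distribʳ-+ K (+ bit (p x)) (+ count p xs) ⟨
    (+ bit (p x) + + count p xs) * K               ≡⟨ cong (_* K) (ℤP.pos-+ (bit (p x)) (count p xs)) ⟨
    + count p (x ∷ xs) * K                         ∎
    where open ≡.≡-Reasoning

  ∑-count₃ : ∀ (p q r : A → Bool) xs a b c →
             ∑[ x ∈ xs ] (+ bit (p x) * a + + bit (q x) * b + + bit (r x) * c) ≡
             + count p xs * a + + count q xs * b + + count r xs * c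
  ∑-count₃ p q r xs a b c =
    ≡.trans (∑-+ xs _ _)
      (cong₂ _+_ (≡.trans (∑-+ xs _ _) (cong₂ _+_ (∑-count p xs a) (∑-count q xs b))) (∑-count r xs c))

  count-cong : ∀ xs {f g : A → Bool} → (∀ {x} → x ∈ xs → f x ≡ g x) → count f xs ≡ count g xs
  count-cong []       eq = refl
  count-cong (x ∷ xs) eq = cong₂ ℕ._+_ (cong bit (eq (here refl))) (count-cong xs (eq ∘ there))

  count-∷ʳ : ∀ (p : A → Bool) w u → count p (w ∷ʳ u) ≡ count p w ℕ.+ bit (p u)
  count-∷ʳ p []      u = ℕP.+-comm (bit (p u)) 0
  count-∷ʳ p (x ∷ w) u = ≡.trans (cong (bit (p x) ℕ.+_) (count-∷ʳ p w u)) (sym (ℕP.+-assoc (bit (p x)) _ _))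

  count-mid-replace : ∀ (p : A → Bool) us y v vs →
                      count p (us ++ v ∷ vs) ℕ.+ bit (p y) ≡ count p (us ++ y ∷ vs) ℕ.+ bit (p v)
  count-mid-replace p []       y v vs = lemma (bit (p v)) (count p vs) (bit (p y))
    where
    lemma : ∀ a b c → a ℕ.+ b ℕ.+ c ≡ c ℕ.+ b ℕ.+ a
    lemma = ℕ-Solver.solve-∀
  count-mid-replace p (x ∷ us) y v vs =
    ≡.trans (ℕP.+-assoc (bit (p x)) _ _)
      (≡.trans (cong (bit (p x) ℕ.+_) (count-mid-replace p us y v vs)) (sym (ℕP.+-assoc (bit (p x)) _ _)))

  count-except : ∀ (key : A → ℕ) {f g : A → Bool} {x} xs → Unique (map key xs) → x ∈ xs →
                 (∀ {e} → e ∈ xs → key e ≢ key x → f e ≡ g e) →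
                 count f xs ℕ.+ bit (g x) ≡ count g xs ℕ.+ bit (f x)
  count-except key {f} {g} (x ∷ xs) (x∉ ∷ _) (here refl) agree =
    ≡.trans (cong (λ c → bit (f x) ℕ.+ c ℕ.+ bit (g x)) rest) (lemma (bit (f x)) (count g xs) (bit (g x)))
    where
    rest : count f xs ≡ count g xs
    rest = count-cong xs (λ e∈ → agree (there e∈) (λ eq → All.lookup x∉ (∈-map⁺ key e∈) (sym eq)))
    lemma : ∀ a b c → a ℕ.+ b ℕ.+ c ≡ c ℕ.+ b ℕ.+ a
    lemma = ℕ-Solver.solve-∀
  count-except key {f} {g} {x} (e ∷ xs) (e∉ ∷ u) (there x∈) agree = begin
    bit (f e) ℕ.+ count f xs ℕ.+ bit (g x)   ≡⟨ ℕP.+-assoc (bit (f e)) _ _ ⟩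
    bit (f e) ℕ.+ (count f xs ℕ.+ bit (g x)) ≡⟨ cong₂ ℕ._+_ (cong bit fe≡ge) (count-except key xs u x∈ (agree ∘ there)) ⟩
    bit (g e) ℕ.+ (count g xs ℕ.+ bit (f x)) ≡⟨ ℕP.+-assoc (bit (g e)) _ _ ⟨
    bit (g e) ℕ.+ count g xs ℕ.+ bit (f x)   ∎
    where
    open ≡.≡-Reasoning
    fe≡ge : f e ≡ g e
    fe≡ge = agree (here refl) (All.lookup e∉ (∈-map⁺ key x∈))

module _ {A B : Set} (f : A → List B) where

  ∈-concatMap-∃ : ∀ xs {y} → y ∈ concatMap f xs → ∃ λ x → x ∈ xs × y ∈ f x
  ∈-concatMap-∃ xs = find ∘ ∈-concatMap⁻ f

  ∈-concatMap-intro : ∀ {xs x y} → x ∈ xs → y ∈ f x → y ∈ concatMap f xs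
  ∈-concatMap-intro x∈xs y∈fx = ∈-concatMap⁺ f (lose x∈xs y∈fx)

  concatMap-unique : ∀ {xs} → Unique xs → (∀ {x} → x ∈ xs → Unique (f x)) →
                     (∀ {x x′ y} → x ∈ xs → x′ ∈ xs → y ∈ f x → y ∈ f x′ → x ≡ x′) →
                     Unique (concatMap f xs)
  concatMap-unique {[]}     _          _     _     = []
  concatMap-unique {x ∷ xs} (x∉ ∷ uxs) ufx fDisj =
    Unique.++⁺ (ufx (here refl)) (concatMap-unique uxs (ufx ∘ there) (λ p q → fDisj (there p) (there q))) disjoint
    where
    disjoint : ∀ {y} → ¬ (y ∈ f x × y ∈ concatMap f xs)
    disjoint (y∈fx , y∈rest) with x′ , x′∈xs , y∈fx′ ← ∈-concatMap-∃ xs y∈rest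
      = All.lookup x∉ x′∈xs (fDisj (here refl) (there x′∈xs) y∈fx y∈fx′)

map-unique-on : ∀ {A B : Set} (f : A → B) {xs} → Unique xs →
                (∀ {x x′} → x ∈ xs → x′ ∈ xs → f x ≡ f x′ → x ≡ x′) → Unique (map f xs)
map-unique-on f {[]}     []         _   = []
map-unique-on f {x ∷ xs} (x∉ ∷ uxs) inj =
  AllP.map⁺ (All.tabulate (λ x′∈ fx≡fx′ → All.lookup x∉ x′∈ (inj (here refl) (there x′∈) fx≡fx′)))
  ∷ map-unique-on f uxs (λ p q → inj (there p) (there q))

module _ {A : Set} where

  unique-⇔⇒↭ : ∀ {xs ys : List A} → Unique xs → Unique ys → (∀ {z} → z ∈ xs ⇔ z ∈ ys) → xs ↭ ys
  unique-⇔⇒↭ ux uy eq = ∼bag⇒↭ (unique∧set⇒bag ux uy eq)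

  unique-resp-↭ : ∀ {xs ys : List A} → xs ↭ ys → Unique xs → Unique ys
  unique-resp-↭ p = PermSetoid.Unique-resp-↭ (≡.setoid A) (↭⇒↭ₛ p)

  ∷ʳ-↭ : ∀ (xs : List A) a → xs ∷ʳ a ↭ a ∷ xs
  ∷ʳ-↭ xs a = ↭-sym (∷↭∷ʳ a xs)

  insert-∷ʳ-↭ : ∀ xs ys (b c : A) → (xs ++ b ∷ ys) ∷ʳ c ↭ b ∷ c ∷ xs ++ ys
  insert-∷ʳ-↭ xs ys b c = trans (∷ʳ-↭ (xs ++ b ∷ ys) c) (trans (prep c (shift b xs ys)) (swap c b refl))

module _ {A : Set} where

  ∈-remove : ∀ xs {ys} {x y : A} → y ∈ xs ++ x ∷ ys → y ≢ x → y ∈ xs ++ ys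
  ∈-remove xs y∈ y≢x with ∈-++⁻ xs y∈
  ... | inj₁ y∈xs         = ∈-++⁺ˡ y∈xs
  ... | inj₂ (here y≡x)   = ⊥-elim (y≢x y≡x)
  ... | inj₂ (there y∈ys) = ∈-++⁺ʳ xs y∈ys

  unique-⊆-length< : ∀ {xs S : List A} {z} → Unique xs → (∀ {x} → x ∈ xs → x ∈ S) → z ∈ S → z ∉ xs →
                     length xs ℕ.< length S
  unique-⊆-length< {[]}     {_ ∷ _}     _          _   _   _  = s≤s z≤n
  unique-⊆-length< {x ∷ xs} {S} {z} (x∉ ∷ uxs) xs⊆ z∈S z∉ with S₁ , S₂ , refl ← ∈-∃++ (xs⊆ (here refl)) =
    subst (suc (length (x ∷ xs)) ℕ.≤_) (sym (length-++-sucʳ S₁ x S₂))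
      (s≤s (unique-⊆-length< uxs xs⊆′ z∈′ (z∉ ∘ there)))
    where
    xs⊆′ : ∀ {y} → y ∈ xs → y ∈ S₁ ++ S₂
    xs⊆′ y∈ = ∈-remove S₁ (xs⊆ (there y∈)) (λ y≡x → All.lookup x∉ y∈ (sym y≡x))
    z∈′ : z ∈ S₁ ++ S₂
    z∈′ = ∈-remove S₁ z∈S (λ z≡x → z∉ (here z≡x))

covers-range : ∀ n {ms : List ℕ} → Unique ms → length ms ≡ n → All (λ m → 1 ℕ.≤ m × m ℕ.≤ n) ms →
         ∀ {k} → 1 ℕ.≤ k → k ℕ.≤ n → k ∈ ms
covers-range n {ms} ums len bounded {suc k} _ k<n with suc k ∈? ms
... | yes k∈ = k∈
... | no  k∉ = ⊥-elim (ℕP.<-irrefl (≡.trans len (sym range-length))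
                                   (unique-⊆-length< ums ms⊆range (∈-range (s≤s z≤n) k<n) k∉))
  where
  range : List ℕ
  range = map suc (upTo n)
  range-length : length range ≡ n
  range-length = ≡.trans (length-map suc (upTo n)) (length-upTo n)
  ∈-range : ∀ {m} → 1 ℕ.≤ m → m ℕ.≤ n → m ∈ range
  ∈-range {suc m} _ m<n = ∈-map⁺ suc (∈-upTo⁺ m<n)
  ms⊆range : ∀ {m} → m ∈ ms → m ∈ range
  ms⊆range m∈ = let 1≤m , m≤n = All.lookup bounded m∈ in ∈-range 1≤m m≤n

-- Signed derangements as windows

record InRange (n : ℕ) (x : ℤ) : Set where
  constructor bounds
  field
    abs≥1 : 1 ℕ.≤ ∣ x ∣
    abs≤  : ∣ x ∣ ℕ.≤ n

InRange-widen : ∀ {n x} → InRange n x → InRange (suc n) x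
InRange-widen (bounds 1≤ ≤n) = bounds 1≤ (ℕP.m≤n⇒m≤1+n ≤n)

InRange-abs : ∀ {n x x′} → ∣ x′ ∣ ≡ ∣ x ∣ → InRange n x → InRange n x′
InRange-abs {n} eq (bounds 1≤ ≤n) = bounds (subst (1 ℕ.≤_) (sym eq) 1≤) (subst (ℕ._≤ n) (sym eq) ≤n)

InRange-narrow : ∀ {n x} → InRange (suc n) x → suc n ≢ ∣ x ∣ → InRange n x
InRange-narrow (bounds 1≤ ≤sn) sn≢ = bounds 1≤ (ℕP.≤-pred (ℕP.≤∧≢⇒< ≤sn (sn≢ ∘ sym)))

InRange-narrow-all : ∀ {n xs} → All (InRange (suc n)) xs → All (suc n ≢_) (map ∣_∣ xs) → All (InRange n) xs
InRange-narrow-all inRange fresh =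
  All.zipWith (λ (z-inRange , z-fresh) → InRange-narrow z-inRange z-fresh) (inRange , AllP.map⁻ fresh)

above-range : ∀ {n} {xs} → All (InRange n) xs → All (suc n ≢_) (map ∣_∣ xs)
above-range = AllP.map⁺ ∘ All.map (λ z-inRange → ℕP.>⇒≢ (s≤s (InRange.abs≤ z-inRange)))

record SignedDerangement (n : ℕ) (w : List ℤ) : Set where
  constructor signedDerangement
  field
    length≡        : length w ≡ n
    inRange        : All (InRange n) w
    absUnique      : Unique (map ∣_∣ w)
    fixedPointFree : T (isDerangement w)

module _ {A : Set} where

  words-sound : ∀ n (xs : List A) {w} → w ∈ words n xs → length w ≡ n × All (_∈ xs) w
  words-sound zero    xs (here refl) = refl , []
  words-sound (suc n) xs w∈
    with x , x∈xs , w∈′ ← ∈-concatMap-∃ (λ x → map (x ∷_) (words n xs)) xs w∈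
    with v , v∈ , refl ← ∈-map⁻ (x ∷_) w∈′
    = Product.map (cong suc) (x∈xs ∷_) (words-sound n xs v∈)

  words-complete : ∀ n (xs : List A) {w} → length w ≡ n → All (_∈ xs) w → w ∈ words n xs
  words-complete zero    xs {[]}    refl []         = here refl
  words-complete (suc n) xs {x ∷ w} len  (x∈xs ∷ w⊆) =
    ∈-concatMap-intro (λ x → map (x ∷_) (words n xs)) x∈xs
      (∈-map⁺ (x ∷_) (words-complete n xs (ℕP.suc-injective len) w⊆))

  words-unique : ∀ n {xs : List A} → Unique xs → Unique (words n xs)
  words-unique zero    _   = [] ∷ []
  words-unique (suc n) uxs =
    concatMap-unique (λ x → map (x ∷_) (words n _)) uxs
      (λ _ → Unique.map⁺ (λ eq → proj₂ (∷-injective eq)) (words-unique n uxs))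
      (λ _ _ y∈ y∈′ → heads y∈ y∈′)
    where
    heads : ∀ {x x′ y} {L : List (List A)} → y ∈ map (x ∷_) L → y ∈ map (x′ ∷_) L → x ≡ x′
    heads y∈ y∈′ with _ , _ , refl ← ∈-map⁻ _ y∈ | _ , _ , eq ← ∈-map⁻ _ y∈′ = proj₁ (∷-injective eq)

∈-pm⁺ : ∀ n {x} → InRange n x → x ∈ pm n
∈-pm⁺ n {+ suc k}    (bounds _ k<n) = ∈-++⁺ˡ (∈-map⁺ (λ k → + suc k) (∈-upTo⁺ k<n))
∈-pm⁺ n { -[1+ k ]} (bounds _ k<n) = ∈-++⁺ʳ _ (∈-map⁺ (λ k → - (+ suc k)) (∈-upTo⁺ k<n))

∈-pm⁻ : ∀ n {x} → x ∈ pm n → InRange n x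
∈-pm⁻ n x∈ with ∈-++⁻ (map (λ k → + suc k) (upTo n)) x∈
... | inj₁ x∈pos with _ , k∈ , refl ← ∈-map⁻ (λ k → + suc k) x∈pos = bounds (s≤s z≤n) (∈-upTo⁻ k∈)
... | inj₂ x∈neg with _ , k∈ , refl ← ∈-map⁻ (λ k → - (+ suc k)) x∈neg = bounds (s≤s z≤n) (∈-upTo⁻ k∈)

pm-unique : ∀ n → Unique (pm n)
pm-unique n =
  Unique.++⁺ (Unique.map⁺ pos-injective (Unique.upTo⁺ n)) (Unique.map⁺ neg-injective (Unique.upTo⁺ n)) disjoint
  where
  pos-injective : ∀ {a b} → + suc a ≡ + suc b → a ≡ b
  pos-injective refl = refl
  neg-injective : ∀ {a b} → - (+ suc a) ≡ - (+ suc b) → a ≡ b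
  neg-injective refl = refl
  disjoint : ∀ {x} → ¬ (x ∈ map (λ k → + suc k) (upTo n) × x ∈ map (λ k → - (+ suc k)) (upTo n))
  disjoint (x∈pos , x∈neg)
    with _ , _ , refl ← ∈-map⁻ (λ k → + suc k) x∈pos | _ , _ , () ← ∈-map⁻ (λ k → - (+ suc k)) x∈neg

T-elemℕ : ∀ k ms → T (elemℕ k ms) ⇔ k ∈ ms
T-elemℕ k []       = mk⇔ (λ ()) (λ ())
T-elemℕ k (m ∷ ms) = mk⇔ to from
  where
  to : T (elemℕ k (m ∷ ms)) → k ∈ m ∷ ms
  to t with Equivalence.to T-∨ t
  ... | inj₁ k≡m  = here (ℕP.≡ᵇ⇒≡ k m k≡m)
  ... | inj₂ k∈ms = there (Equivalence.to (T-elemℕ k ms) k∈ms)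
  from : k ∈ m ∷ ms → T (elemℕ k (m ∷ ms))
  from (here k≡m)   = Equivalence.from T-∨ (inj₁ (ℕP.≡⇒≡ᵇ k m k≡m))
  from (there k∈ms) = Equivalence.from T-∨ (inj₂ (Equivalence.from (T-elemℕ k ms) k∈ms))

T-distinct : ∀ ms → T (distinct ms) ⇔ Unique ms
T-distinct []       = mk⇔ (λ _ → []) (λ _ → _)
T-distinct (m ∷ ms) = mk⇔ to from
  where
  to : T (distinct (m ∷ ms)) → Unique (m ∷ ms)
  to t with elemℕ m ms in m∈?
  to () | true
  to t  | false =
    All.tabulate (λ m′∈ m≡m′ → subst T m∈? (Equivalence.from (T-elemℕ m ms) (subst (_∈ ms) (sym m≡m′) m′∈)))
    ∷ Equivalence.to (T-distinct ms) t
  from : Unique (m ∷ ms) → T (distinct (m ∷ ms))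
  from (m∉ ∷ u) with elemℕ m ms in m∈?
  ... | true  = ⊥-elim (All.lookup m∉ (Equivalence.to (T-elemℕ m ms) (subst T (sym m∈?) _)) refl)
  ... | false = Equivalence.from (T-distinct ms) u

∈-DBn⇔ : ∀ n {w} → w ∈ DBn n ⇔ SignedDerangement n w
∈-DBn⇔ n {w} = mk⇔ to from
  where
  to : w ∈ DBn n → SignedDerangement n w
  to w∈ with w∈Bn , noFix ← ∈-filter⁻ (λ w → T? (isDerangement w)) w∈
        with w∈words , signed ← ∈-filter⁻ (λ w → T? (isSignedPerm w)) w∈Bn
        with len , w⊆ ← words-sound n (pm n) w∈words
    = signedDerangement len (All.map (∈-pm⁻ n) w⊆) (Equivalence.to (T-distinct _) signed) noFix
  from : SignedDerangement n w → w ∈ DBn n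
  from (signedDerangement len inRange absUnique noFix) =
    ∈-filter⁺ (λ w → T? (isDerangement w))
      (∈-filter⁺ (λ w → T? (isSignedPerm w))
        (words-complete n (pm n) len (All.map (∈-pm⁺ n) inRange))
        (Equivalence.from (T-distinct _) absUnique))
      noFix

DBn-unique : ∀ n → Unique (DBn n)
DBn-unique n = Unique.filter⁺ (λ w → T? (isDerangement w))
  (Unique.filter⁺ (λ w → T? (isSignedPerm w)) (words-unique n (pm-unique n)))

T-not-does : ∀ {A : Set} (a? : Dec A) → T (not (does a?)) ⇔ (¬ A)
T-not-does (yes a) = mk⇔ (λ ()) (λ ¬a → ¬a a)
T-not-does (no ¬a) = mk⇔ (λ _ → ¬a) (λ _ → _)

T-noFixed-∷ : ∀ i x xs → T (noFixedAux i (x ∷ xs)) ⇔ (x ≢ + i × T (noFixedAux (suc i) xs))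
T-noFixed-∷ i x xs = mk⇔
  (λ t → let x≢ , rest = Equivalence.to T-∧ t in Equivalence.to (T-not-does (x ℤP.≟ + i)) x≢ , rest)
  (λ (x≢ , rest) → Equivalence.from T-∧ (Equivalence.from (T-not-does (x ℤP.≟ + i)) x≢ , rest))

noFixed-++ : ∀ i xs ys → noFixedAux i (xs ++ ys) ≡ noFixedAux i xs ∧ noFixedAux (i ℕ.+ length xs) ys
noFixed-++ i []       ys = cong (λ j → noFixedAux j ys) (sym (ℕP.+-identityʳ i))
noFixed-++ i (x ∷ xs) ys rewrite noFixed-++ (suc i) xs ys | ℕP.+-suc i (length xs) =
  sym (∧-assoc (not (does (x ℤP.≟ + i))) _ _)

T-noFixed-++ : ∀ i xs ys → T (noFixedAux i (xs ++ ys)) ⇔ (T (noFixedAux i xs) × T (noFixedAux (i ℕ.+ length xs) ys))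
T-noFixed-++ i xs ys = mk⇔
  (λ t → Equivalence.to T-∧ (subst T (noFixed-++ i xs ys) t))
  (λ ts → subst T (sym (noFixed-++ i xs ys)) (Equivalence.from T-∧ ts))

noFixed-mid⁻ : ∀ us e vs → T (isDerangement (us ++ e ∷ vs)) → e ≢ + suc (length us)
noFixed-mid⁻ us e vs t =
  proj₁ (Equivalence.to (T-noFixed-∷ _ e vs) (proj₂ (Equivalence.to (T-noFixed-++ 1 us (e ∷ vs)) t)))

noFixed-mid-replace : ∀ us e e′ vs → T (isDerangement (us ++ e ∷ vs)) → e′ ≢ + suc (length us) →
                      T (isDerangement (us ++ e′ ∷ vs))
noFixed-mid-replace us e e′ vs t e′≢ =
  let tus , te = Equivalence.to (T-noFixed-++ 1 us (e ∷ vs)) t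
      _ , tvs  = Equivalence.to (T-noFixed-∷ _ e vs) te
  in Equivalence.from (T-noFixed-++ 1 us (e′ ∷ vs)) (tus , Equivalence.from (T-noFixed-∷ _ e′ vs) (e′≢ , tvs))

noFixed-∷ʳ⁺ : ∀ w u → T (isDerangement w) → u ≢ + suc (length w) → T (isDerangement (w ∷ʳ u))
noFixed-∷ʳ⁺ w u t u≢ = Equivalence.from (T-noFixed-++ 1 w [ u ]) (t , Equivalence.from (T-noFixed-∷ _ u []) (u≢ , _))

noFixed-∷ʳ⁻ : ∀ w u → T (isDerangement (w ∷ʳ u)) → T (isDerangement w) × u ≢ + suc (length w)
noFixed-∷ʳ⁻ w u t = let tw , tu = Equivalence.to (T-noFixed-++ 1 w [ u ]) t
                    in tw , proj₁ (Equivalence.to (T-noFixed-∷ _ u []) tu)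

abs-onto : ∀ {n w} → SignedDerangement n w → ∀ {k} → 1 ℕ.≤ k → k ℕ.≤ n → ∃ λ x → x ∈ w × k ≡ ∣ x ∣
abs-onto {n} {w} (signedDerangement len inRange absUnique _) 1≤k k≤n =
  ∈-map⁻ ∣_∣ (covers-range n absUnique (≡.trans (length-map ∣_∣ w) len)
                (AllP.map⁺ (All.map (λ (bounds 1≤ ≤n) → 1≤ , ≤n) inRange)) 1≤k k≤n)

entryWithAbs : ℕ → List ℤ → ℤ
entryWithAbs m []       = + 0
entryWithAbs m (x ∷ xs) = if ∣ x ∣ ℕ.≡ᵇ m then x else entryWithAbs m xs

entryWithAbs-unique : ∀ {x} w → Unique (map ∣_∣ w) → x ∈ w → entryWithAbs ∣ x ∣ w ≡ x
entryWithAbs-unique {x} (z ∷ w) (z∉ ∷ u) x∈ with ∣ z ∣ ℕ.≡ᵇ ∣ x ∣ in eq | x∈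
... | true  | here refl = refl
... | true  | there x∈w = ⊥-elim (All.lookup z∉ (∈-map⁺ ∣_∣ x∈w) (ℕP.≡ᵇ⇒≡ _ _ (subst T (sym eq) _)))
... | false | here refl = ⊥-elim (subst T eq (ℕP.≡⇒≡ᵇ ∣ x ∣ ∣ x ∣ refl))
... | false | there x∈w = entryWithAbs-unique w u x∈w

abs-injective-on : ∀ {w x x′} → Unique (map ∣_∣ w) → x ∈ w → x′ ∈ w → ∣ x ∣ ≡ ∣ x′ ∣ → x ≡ x′
abs-injective-on {w} absUnique x∈ x′∈ eq =
  ≡.trans (sym (entryWithAbs-unique w absUnique x∈))
    (≡.trans (cong (λ m → entryWithAbs m w) eq) (entryWithAbs-unique w absUnique x′∈))

setAt : List ℤ → ℕ → ℤ → List ℤ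
setAt []       _             v = []
setAt (x ∷ xs) zero          v = x ∷ xs
setAt (x ∷ xs) (suc zero)    v = v ∷ xs
setAt (x ∷ xs) (suc (suc k)) v = x ∷ setAt xs (suc k) v

at-mid : ∀ us (e : ℤ) vs → at (us ++ e ∷ vs) (suc (length us)) ≡ e
at-mid []       e vs = refl
at-mid (u ∷ us) e vs = at-mid us e vs

setAt-mid : ∀ us (e : ℤ) vs v → setAt (us ++ e ∷ vs) (suc (length us)) v ≡ us ++ v ∷ vs
setAt-mid []       e vs v = refl
setAt-mid (u ∷ us) e vs v = cong (u ∷_) (setAt-mid us e vs v)

at-mid-other : ∀ us (e e′ : ℤ) vs m → m ≢ suc (length us) → at (us ++ e ∷ vs) m ≡ at (us ++ e′ ∷ vs) m
at-mid-other []       e e′ vs zero          m≢ = refl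
at-mid-other []       e e′ vs (suc zero)    m≢ = ⊥-elim (m≢ refl)
at-mid-other []       e e′ vs (suc (suc m)) m≢ = refl
at-mid-other (u ∷ us) e e′ vs zero          m≢ = refl
at-mid-other (u ∷ us) e e′ vs (suc zero)    m≢ = refl
at-mid-other (u ∷ us) e e′ vs (suc (suc m)) m≢ = at-mid-other us e e′ vs (suc m) (m≢ ∘ cong suc)

at-∷ʳ : ∀ w (u : ℤ) m → m ℕ.≤ length w → at (w ∷ʳ u) m ≡ at w m
at-∷ʳ []      u zero          _         = refl
at-∷ʳ (x ∷ w) u zero          _         = refl
at-∷ʳ (x ∷ w) u (suc zero)    _         = refl
at-∷ʳ (x ∷ w) u (suc (suc m)) (s≤s m≤) = at-∷ʳ w u (suc m) m≤

at-last : ∀ w (u : ℤ) → at (w ∷ʳ u) (suc (length w)) ≡ u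
at-last w u = at-mid w u []

splitAtPosition : ∀ (w : List ℤ) k → 1 ℕ.≤ k → k ℕ.≤ length w →
                  ∃ λ us → ∃ λ e → ∃ λ vs → w ≡ us ++ e ∷ vs × suc (length us) ≡ k
splitAtPosition (x ∷ w) (suc zero)    _ _         = [] , x , w , refl , refl
splitAtPosition (x ∷ w) (suc (suc k)) _ (s≤s k≤)
  with us , e , vs , refl , len ← splitAtPosition w (suc k) (s≤s z≤n) k≤
  = x ∷ us , e , vs , refl , cong suc len

splitAtEntry : ∀ {n σ x} → SignedDerangement n σ → x ∈ σ →
               ∃ λ us → ∃ λ y → ∃ λ vs → σ ≡ us ++ y ∷ vs × suc (length us) ≡ ∣ x ∣
splitAtEntry {σ = σ} (signedDerangement len inRange _ _) x∈ =
  let bounds 1≤ ≤n = All.lookup inRange x∈ in splitAtPosition σ _ 1≤ (subst (_ ℕ.≤_) (sym len) ≤n)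

length-mid : ∀ (us : List ℤ) a b vs → length (us ++ a ∷ vs) ≡ length (us ++ b ∷ vs)
length-mid us a b vs = ≡.trans (length-++-sucʳ us a vs) (sym (length-++-sucʳ us b vs))

positionOfAbs : ℕ → List ℤ → ℕ
positionOfAbs m []       = 0
positionOfAbs m (x ∷ xs) = if ∣ x ∣ ℕ.≡ᵇ m then 1 else suc (positionOfAbs m xs)

positionOfAbs-mid : ∀ m us e vs → All (λ z → ∣ z ∣ ≢ m) us → ∣ e ∣ ≡ m →
                    positionOfAbs m (us ++ e ∷ vs) ≡ suc (length us)
positionOfAbs-mid m []       e vs []          ∣e∣≡m with ∣ e ∣ ℕ.≡ᵇ m in eq
... | true  = refl
... | false = ⊥-elim (subst T eq (ℕP.≡⇒≡ᵇ _ _ ∣e∣≡m))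
positionOfAbs-mid m (z ∷ us) e vs (z≢ ∷ us≢) ∣e∣≡m with ∣ z ∣ ℕ.≡ᵇ m in eq
... | true  = ⊥-elim (z≢ (ℕP.≡ᵇ⇒≡ _ _ (subst T (sym eq) _)))
... | false = cong suc (positionOfAbs-mid m us e vs us≢ ∣e∣≡m)

-- Comparisons with ±(n+1)

-- wexc and aexc are, definitionally, stat _<ᵇ_ and stat _>ᵇ_.
stat : (ℤ → ℤ → Bool) → List ℤ → ℕ
stat R w = count (λ x → R x (at w ∣ x ∣)) w

_<ᵇ_ _>ᵇ_ : ℤ → ℤ → Bool
a <ᵇ b = does (a ℤP.<? b)
a >ᵇ b = does (b ℤP.<? a)

signed : Bool → ℤ → ℤ
signed true  z = z
signed false z = - z

∣signed∣ : ∀ s z → ∣ signed s z ∣ ≡ ∣ z ∣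
∣signed∣ true  z = refl
∣signed∣ false z = ℤP.∣-i∣≡∣i∣ z

isPositive : ℤ → Bool
isPositive (+ _)    = true
isPositive -[1+ _ ] = false

isPositive-signed : ∀ n s → isPositive (signed s (+ suc n)) ≡ s
isPositive-signed n true  = refl
isPositive-signed n false = refl

signed-isPositive : ∀ {n} e → ∣ e ∣ ≡ suc n → signed (isPositive e) (+ suc n) ≡ e
signed-isPositive (+ _)    refl = refl
signed-isPositive -[1+ _ ] refl = refl

abs-neg : ∀ {y k} → ∣ y ∣ ≡ k → y ≢ + k → y ≡ - (+ k)
abs-neg {+ _}      refl y≢ = ⊥-elim (y≢ refl)
abs-neg { -[1+ _ ]} refl _  = refl

abs-top : ∀ {n} u → ∣ u ∣ ≡ suc n → u ≡ + suc n ⊎ u ≡ - (+ suc n)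
abs-top (+ _)    refl = inj₁ refl
abs-top -[1+ _ ] refl = inj₂ refl

record SeparatedBy (n : ℕ) (R : ℤ → ℤ → Bool) : Set where
  field
    irreflexive : ∀ a → R a a ≡ false
    separates   : ∀ s {a b} → ∣ a ∣ ℕ.≤ n → ∣ b ∣ ℕ.≤ n →
                  bit (R a (signed s (+ suc n))) ℕ.+ bit (R (signed s (+ suc n)) b) ≡ 1

below-top : ∀ n a → ∣ a ∣ ℕ.≤ n → a ℤ.< + suc n
below-top n (+ _)    a≤n = ℤ.+<+ (s≤s a≤n)
below-top n -[1+ _ ] _   = ℤ.-<+

above-bottom : ∀ n a → ∣ a ∣ ℕ.≤ n → - (+ suc n) ℤ.< a
above-bottom n (+ _)    _   = ℤ.-<+
above-bottom n -[1+ _ ] a≤n = ℤ.-<- a≤n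

<ᵇ-signed : ∀ n s a → ∣ a ∣ ℕ.≤ n → a <ᵇ signed s (+ suc n) ≡ s
<ᵇ-signed n true  a a≤n = dec-true  (a ℤP.<? _) (below-top n a a≤n)
<ᵇ-signed n false a a≤n = dec-false (a ℤP.<? _) (ℤP.<-asym (above-bottom n a a≤n))

signed-<ᵇ : ∀ n s a → ∣ a ∣ ℕ.≤ n → signed s (+ suc n) <ᵇ a ≡ not s
signed-<ᵇ n true  a a≤n = dec-false (_ ℤP.<? a) (ℤP.<-asym (below-top n a a≤n))
signed-<ᵇ n false a a≤n = dec-true  (_ ℤP.<? a) (above-bottom n a a≤n)

bit-not : ∀ s → bit s ℕ.+ bit (not s) ≡ 1
bit-not true  = refl
bit-not false = refl

<ᵇ-irrefl : ∀ a → a <ᵇ a ≡ false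
<ᵇ-irrefl a = dec-false (a ℤP.<? a) (ℤP.<-irrefl refl)

<ᵇ-separated : ∀ n → SeparatedBy n _<ᵇ_
<ᵇ-separated n = record
  { irreflexive = <ᵇ-irrefl
  ; separates   = λ s {a} {b} a≤n b≤n →
      ≡.subst₂ (λ p q → bit p ℕ.+ bit q ≡ 1) (sym (<ᵇ-signed n s a a≤n)) (sym (signed-<ᵇ n s b b≤n)) (bit-not s)
  }

>ᵇ-separated : ∀ n → SeparatedBy n _>ᵇ_
>ᵇ-separated n = record
  { irreflexive = <ᵇ-irrefl
  ; separates   = λ s {a} {b} a≤n b≤n →
      ≡.subst₂ (λ p q → bit p ℕ.+ bit q ≡ 1) (sym (signed-<ᵇ n s a a≤n)) (sym (<ᵇ-signed n s b b≤n))
        (≡.trans (ℕP.+-comm (bit (not s)) (bit s)) (bit-not s))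
  }

-- Extending a derangement of [n] to one of [n+1]

data Extension : Set where
  append   : Extension
  displace : ℤ → Bool → Bool → Extension

extend : ℕ → List ℤ → Extension → List ℤ
extend n σ append           = σ ∷ʳ - (+ suc n)
extend n σ (displace x s t) = setAt σ ∣ x ∣ (signed s (+ suc n)) ∷ʳ signed t (at σ ∣ x ∣)

neutral : List ℤ → ℤ → Bool
neutral σ x = does (at σ ∣ x ∣ ℤP.≟ x)

options : List ℤ → ℤ → List Extension
options σ x = displace x true true ∷ displace x false true ∷
  (if neutral σ x then displace x true false ∷ displace x false false ∷ [] else [])

extensions : List ℤ → List Extension
extensions σ = append ∷ concatMap (options σ) σ

Admissible : List ℤ → ℤ → Bool → Set
Admissible σ x t = t ≡ true ⊎ at σ ∣ x ∣ ≡ x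

∈-options⁻ : ∀ σ x {c} → c ∈ options σ x → ∃ λ s → ∃ λ t → c ≡ displace x s t × Admissible σ x t
∈-options⁻ σ x (here refl)         = true , true , refl , inj₁ refl
∈-options⁻ σ x (there (here refl)) = false , true , refl , inj₁ refl
∈-options⁻ σ x (there (there c∈)) with at σ ∣ x ∣ ℤP.≟ x | c∈
... | yes fixed | here refl         = true , false , refl , inj₂ fixed
... | yes fixed | there (here refl) = false , false , refl , inj₂ fixed

∈-options⁺ : ∀ σ x s t → Admissible σ x t → displace x s t ∈ options σ x
∈-options⁺ σ x true  true  _            = here refl
∈-options⁺ σ x false true  _            = there (here refl)
∈-options⁺ σ x s     false (inj₂ fixed) with at σ ∣ x ∣ ℤP.≟ x
... | no ¬fixed = ⊥-elim (¬fixed fixed)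
∈-options⁺ σ x true  false (inj₂ fixed) | yes _ = there (there (here refl))
∈-options⁺ σ x false false (inj₂ fixed) | yes _ = there (there (there (here refl)))

options-unique : ∀ σ x → Unique (options σ x)
options-unique σ x with neutral σ x
... | true  = ((λ ()) ∷ (λ ()) ∷ (λ ()) ∷ []) ∷ ((λ ()) ∷ (λ ()) ∷ []) ∷ ((λ ()) ∷ []) ∷ [] ∷ []
... | false = ((λ ()) ∷ []) ∷ [] ∷ []

length-options : ∀ σ x → length (options σ x) ≡ (if neutral σ x then 4 else 2)
length-options σ x with neutral σ x
... | true  = refl
... | false = refl

∈-extensions⁻ : ∀ σ {c} → c ∈ extensions σ →
                c ≡ append ⊎ ∃ λ x → ∃ λ s → ∃ λ t → c ≡ displace x s t × x ∈ σ × Admissible σ x t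
∈-extensions⁻ σ (here refl) = inj₁ refl
∈-extensions⁻ σ (there c∈)
  with x , x∈ , c∈options ← ∈-concatMap-∃ (options σ) σ c∈
  with s , t , refl , admissible ← ∈-options⁻ σ x c∈options
  = inj₂ (x , s , t , refl , x∈ , admissible)

extensions-unique : ∀ {n σ} → SignedDerangement n σ → Unique (extensions σ)
extensions-unique {σ = σ} valid =
  All.tabulate append-fresh
  ∷ concatMap-unique (options σ) (Unique.map⁻ (SignedDerangement.absUnique valid))
                     (λ _ → options-unique σ _) same-entry
  where
  append-fresh : ∀ {c} → c ∈ concatMap (options σ) σ → append ≢ c
  append-fresh c∈ append≡c
    with x , _ , c∈options ← ∈-concatMap-∃ (options σ) σ c∈
    with _ , _ , c≡ , _ ← ∈-options⁻ σ x c∈options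
    with () ← ≡.trans append≡c c≡
  same-entry : ∀ {x x′ c} → x ∈ σ → x′ ∈ σ → c ∈ options σ x → c ∈ options σ x′ → x ≡ x′
  same-entry {x} {x′} _ _ c∈ c∈′
    with _ , _ , refl , _ ← ∈-options⁻ σ x c∈
    with _ , _ , refl , _ ← ∈-options⁻ σ x′ c∈′
    = refl

module Displacement (n : ℕ) (us : List ℤ) (y : ℤ) (vs : List ℤ) (s t : Bool)
                    (len : length (us ++ y ∷ vs) ≡ n) where

  σ ρ π : List ℤ
  k : ℕ
  v u : ℤ
  σ = us ++ y ∷ vs
  k = suc (length us)
  v = signed s (+ suc n)
  u = signed t y
  ρ = us ++ v ∷ vs
  π = ρ ∷ʳ u

  extend-displace : ∀ {x} → ∣ x ∣ ≡ k → extend n σ (displace x s t) ≡ π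
  extend-displace ∣x∣≡k rewrite ∣x∣≡k = cong₂ _∷ʳ_ (setAt-mid us y vs v) (cong (signed t) (at-mid us y vs))

  length-ρ : length ρ ≡ n
  length-ρ = ≡.trans (length-++-sucʳ us v vs) (≡.trans (sym (length-++-sucʳ us y vs)) len)

  k≤n : k ℕ.≤ n
  k≤n = subst (k ℕ.≤_) (≡.trans (sym (length-++-sucʳ us y vs)) len) (s≤s (length-++-≤ˡ us))

  at-π-other : ∀ m → m ℕ.≤ n → m ≢ k → at π m ≡ at σ m
  at-π-other m m≤n m≢k = ≡.trans (at-∷ʳ ρ u m (subst (m ℕ.≤_) (sym length-ρ) m≤n)) (at-mid-other us v y vs m m≢k)

  at-π-k : at π k ≡ v
  at-π-k = ≡.trans (at-∷ʳ ρ u k (subst (k ℕ.≤_) (sym length-ρ) k≤n)) (at-mid us v vs)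

  at-π-last : at π (suc n) ≡ u
  at-π-last = subst (λ l → at π (suc l) ≡ u) length-ρ (at-last ρ u)

  σ-↭ : σ ↭ y ∷ us ++ vs
  σ-↭ = shift y us vs

  π-↭ : π ↭ v ∷ u ∷ us ++ vs
  π-↭ = insert-∷ʳ-↭ us vs v u

  at-σ-k : at σ k ≡ y
  at-σ-k = at-mid us y vs

  valid-π : SignedDerangement n σ → SignedDerangement (suc n) π
  valid-π (signedDerangement _ inRange absUnique fixedPointFree) = signedDerangement
    (≡.trans (↭-length π-↭) (cong suc (≡.trans (sym (↭-length σ-↭)) len)))
    (All-resp-↭ (↭-sym π-↭) (v-inRange ∷ InRange-widen u-inRange ∷ All.map InRange-widen rest-inRange))
    (unique-resp-↭ (PermProp.map⁺ ∣_∣ (↭-sym π-↭))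
                   (top-fresh ∷ subst (λ a → Unique (a ∷ _)) (sym ∣u∣≡∣y∣) rest-unique))
    (noFixed-∷ʳ⁺ ρ u (noFixed-mid-replace us y v vs fixedPointFree v≢k) u≢last)
    where
    ∣u∣≡∣y∣ : ∣ u ∣ ≡ ∣ y ∣
    ∣u∣≡∣y∣ = ∣signed∣ t y
    ∣v∣≡ : ∣ v ∣ ≡ suc n
    ∣v∣≡ = ∣signed∣ s (+ suc n)
    y∷rest-inRange : All (InRange n) (y ∷ us ++ vs)
    y∷rest-inRange = All-resp-↭ σ-↭ inRange
    rest-inRange : All (InRange n) (us ++ vs)
    rest-inRange = All.tail y∷rest-inRange
    u-inRange : InRange n u
    u-inRange = InRange-abs ∣u∣≡∣y∣ (All.head y∷rest-inRange)
    rest-unique : Unique (∣ y ∣ ∷ map ∣_∣ (us ++ vs))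
    rest-unique = unique-resp-↭ (PermProp.map⁺ ∣_∣ σ-↭) absUnique
    v-inRange : InRange (suc n) v
    v-inRange = bounds (subst (1 ℕ.≤_) (sym ∣v∣≡) (s≤s z≤n)) (ℕP.≤-reflexive ∣v∣≡)
    exceeds : ∀ {m} → m ℕ.≤ n → ∣ v ∣ ≢ m
    exceeds m≤n eq = ℕP.<-irrefl (≡.trans (sym eq) ∣v∣≡) (s≤s m≤n)
    top-fresh : All (∣ v ∣ ≢_) (∣ u ∣ ∷ map ∣_∣ (us ++ vs))
    top-fresh = AllP.map⁺ (All.map (exceeds ∘ InRange.abs≤) (u-inRange ∷ rest-inRange))
    v≢k : v ≢ + k
    v≢k eq = exceeds k≤n (cong ∣_∣ eq)
    u≢last : u ≢ + suc (length ρ)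
    u≢last eq =
      exceeds (InRange.abs≤ u-inRange) (≡.trans ∣v∣≡ (≡.trans (cong suc (sym length-ρ)) (sym (cong ∣_∣ eq))))

  valid-σ : SignedDerangement (suc n) π → y ≢ + k → SignedDerangement n σ
  valid-σ (signedDerangement _ inRange absUnique fixedPointFree) y≢k = signedDerangement
    len
    (All-resp-↭ (↭-sym σ-↭) (InRange-abs (sym ∣u∣≡∣y∣) (All.head rest-inRange) ∷ All.tail rest-inRange))
    (unique-resp-↭ (PermProp.map⁺ ∣_∣ (↭-sym σ-↭))
                   (subst (λ a → Unique (a ∷ _)) ∣u∣≡∣y∣ rest-unique))
    (noFixed-mid-replace us v y vs (proj₁ (noFixed-∷ʳ⁻ ρ u fixedPointFree)) y≢k)
    where
    ∣u∣≡∣y∣ : ∣ u ∣ ≡ ∣ y ∣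
    ∣u∣≡∣y∣ = ∣signed∣ t y
    v∷rest-unique : Unique (∣ v ∣ ∷ ∣ u ∣ ∷ map ∣_∣ (us ++ vs))
    v∷rest-unique = unique-resp-↭ (PermProp.map⁺ ∣_∣ π-↭) absUnique
    rest-unique : Unique (∣ u ∣ ∷ map ∣_∣ (us ++ vs))
    rest-unique = AllPairs.tail v∷rest-unique
    rest-inRange : All (InRange n) (u ∷ us ++ vs)
    rest-inRange =
      InRange-narrow-all (All.tail (All-resp-↭ π-↭ inRange))
        (subst (λ m → All (m ≢_) (∣ u ∣ ∷ map ∣_∣ (us ++ vs))) (∣signed∣ s (+ suc n)) (AllPairs.head v∷rest-unique))

  stat-balance : ∀ R → SignedDerangement n σ → ∀ {x} → x ∈ σ → ∣ x ∣ ≡ k →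
                 stat R π ℕ.+ bit (R y (at π ∣ y ∣)) ℕ.+ bit (R x y) ≡
                 stat R σ ℕ.+ (bit (R x v) ℕ.+ bit (R v u) ℕ.+ bit (R u (at π ∣ u ∣)))
  stat-balance R (signedDerangement _ inRange absUnique _) {x} x∈ ∣x∣≡k = begin
    stat R π ℕ.+ bit (Pπ y) ℕ.+ bit (R x y)
      ≡⟨ cong (λ z → stat R π ℕ.+ bit (Pπ y) ℕ.+ bit (R x z)) (≡.trans (sym at-σ-k) (cong (at σ) (sym ∣x∣≡k))) ⟩
    count Pπ (ρ ∷ʳ u) ℕ.+ bit (Pπ y) ℕ.+ bit (Pσ x)
      ≡⟨ cong (λ c → c ℕ.+ bit (Pπ y) ℕ.+ bit (Pσ x)) (count-∷ʳ Pπ ρ u) ⟩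
    count Pπ ρ ℕ.+ bit (Pπ u) ℕ.+ bit (Pπ y) ℕ.+ bit (Pσ x)
      ≡⟨ rearrange (count Pπ ρ) (bit (Pπ u)) (bit (Pπ y)) (bit (Pσ x)) ⟩
    count Pπ ρ ℕ.+ bit (Pπ y) ℕ.+ bit (Pσ x) ℕ.+ bit (Pπ u)
      ≡⟨ cong (λ c → c ℕ.+ bit (Pσ x) ℕ.+ bit (Pπ u)) (count-mid-replace Pπ us y v vs) ⟩
    count Pπ σ ℕ.+ bit (Pπ v) ℕ.+ bit (Pσ x) ℕ.+ bit (Pπ u)
      ≡⟨ cong (ℕ._+ bit (Pπ u)) (swap-last (count Pπ σ) (bit (Pπ v)) (bit (Pσ x))) ⟩
    count Pπ σ ℕ.+ bit (Pσ x) ℕ.+ bit (Pπ v) ℕ.+ bit (Pπ u)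
      ≡⟨ cong (λ c → c ℕ.+ bit (Pπ v) ℕ.+ bit (Pπ u)) σ-side ⟩
    stat R σ ℕ.+ bit (Pπ x) ℕ.+ bit (Pπ v) ℕ.+ bit (Pπ u)
      ≡⟨ cong₂ (λ X V → stat R σ ℕ.+ bit X ℕ.+ bit V ℕ.+ bit (Pπ u)) Pπx Pπv ⟩
    stat R σ ℕ.+ bit (R x v) ℕ.+ bit (R v u) ℕ.+ bit (Pπ u)
      ≡⟨ regroup (stat R σ) (bit (R x v)) (bit (R v u)) (bit (Pπ u)) ⟩
    stat R σ ℕ.+ (bit (R x v) ℕ.+ bit (R v u) ℕ.+ bit (Pπ u)) ∎
    where
    open ≡.≡-Reasoning
    Pπ Pσ : ℤ → Bool
    Pπ e = R e (at π ∣ e ∣)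
    Pσ e = R e (at σ ∣ e ∣)
    Pπx : Pπ x ≡ R x v
    Pπx = cong (R x) (≡.trans (cong (at π) ∣x∣≡k) at-π-k)
    Pπv : Pπ v ≡ R v u
    Pπv = cong (R v) (≡.trans (cong (at π) (∣signed∣ s (+ suc n))) at-π-last)
    -- Only the entry x of σ looks at position k, the one position where π and σ differ below n+1.
    σ-side : count Pπ σ ℕ.+ bit (Pσ x) ≡ stat R σ ℕ.+ bit (Pπ x)
    σ-side = count-except ∣_∣ σ absUnique x∈ λ e∈ ∣e∣≢∣x∣ →
      cong (R _) (at-π-other _ (InRange.abs≤ (All.lookup inRange e∈))
                                (λ eq → ∣e∣≢∣x∣ (≡.trans eq (sym ∣x∣≡k))))
    rearrange : ∀ c a b e → c ℕ.+ a ℕ.+ b ℕ.+ e ≡ c ℕ.+ b ℕ.+ e ℕ.+ a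
    rearrange = ℕ-Solver.solve-∀
    swap-last : ∀ a b c → a ℕ.+ b ℕ.+ c ≡ a ℕ.+ c ℕ.+ b
    swap-last = ℕ-Solver.solve-∀
    regroup : ∀ a b c e → a ℕ.+ b ℕ.+ c ℕ.+ e ≡ a ℕ.+ (b ℕ.+ c ℕ.+ e)
    regroup = ℕ-Solver.solve-∀

  new-comparisons : ∀ R → SeparatedBy n R → SignedDerangement n σ → ∀ {x} → x ∈ σ → ∣ x ∣ ≡ k →
                    Admissible σ x t →
                    bit (R x v) ℕ.+ bit (R v u) ℕ.+ bit (R u (at π ∣ u ∣)) ≡ 1 ℕ.+ bit (R y (at π ∣ y ∣))
  new-comparisons R separated valid {x} x∈ ∣x∣≡k (inj₁ t≡true) = cong₂ ℕ._+_
    (subst (λ w → bit (R x v) ℕ.+ bit (R v w) ≡ 1) (sym u≡y)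
           (separates s (bounded x∈) (bounded (∈-++⁺ʳ us (here refl)))))
    (cong (λ w → bit (R w (at π ∣ w ∣))) u≡y)
    where
    open SeparatedBy separated
    bounded : ∀ {e} → e ∈ σ → ∣ e ∣ ℕ.≤ n
    bounded = InRange.abs≤ ∘ All.lookup (SignedDerangement.inRange valid)
    u≡y : u ≡ y
    u≡y = cong (λ b → signed b y) t≡true
  new-comparisons R separated valid {x} x∈ ∣x∣≡k (inj₂ fixed) = begin
    bit (R x v) ℕ.+ bit (R v u) ℕ.+ bit (R u (at π ∣ u ∣))
      ≡⟨ cong (λ z → bit (R x v) ℕ.+ bit (R v u) ℕ.+ bit (R u z)) (at-π-abs {u} ∣u∣≡k) ⟩
    bit (R x v) ℕ.+ bit (R v u) ℕ.+ bit (R u v)            ≡⟨ reverse (bit (R x v)) (bit (R v u)) (bit (R u v)) ⟩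
    bit (R u v) ℕ.+ bit (R v u) ℕ.+ bit (R x v)            ≡⟨ cong (ℕ._+ bit (R x v)) (separates s ∣u∣≤n ∣u∣≤n) ⟩
    1 ℕ.+ bit (R x v)                                      ≡⟨ cong (λ z → 1 ℕ.+ bit (R z v)) y≡x ⟨
    1 ℕ.+ bit (R y v)                                      ≡⟨ cong (λ z → 1 ℕ.+ bit (R y z)) (at-π-abs {y} ∣y∣≡k) ⟨
    1 ℕ.+ bit (R y (at π ∣ y ∣))                            ∎
    where
    open ≡.≡-Reasoning
    open SeparatedBy separated
    y≡x : y ≡ x
    y≡x = ≡.trans (sym (≡.trans (cong (at σ) ∣x∣≡k) at-σ-k)) fixed
    ∣y∣≡k : ∣ y ∣ ≡ k
    ∣y∣≡k = ≡.trans (cong ∣_∣ y≡x) ∣x∣≡k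
    ∣u∣≡k : ∣ u ∣ ≡ k
    ∣u∣≡k = ≡.trans (∣signed∣ t y) ∣y∣≡k
    ∣u∣≤n : ∣ u ∣ ℕ.≤ n
    ∣u∣≤n = subst (ℕ._≤ n) (sym ∣u∣≡k) k≤n
    at-π-abs : ∀ {z} → ∣ z ∣ ≡ k → at π ∣ z ∣ ≡ v
    at-π-abs ∣z∣≡k = ≡.trans (cong (at π) ∣z∣≡k) at-π-k
    reverse : ∀ a b c → a ℕ.+ b ℕ.+ c ≡ c ℕ.+ b ℕ.+ a
    reverse = ℕ-Solver.solve-∀

  stat-displace : ∀ R → SeparatedBy n R → SignedDerangement n σ → ∀ {x} → x ∈ σ → ∣ x ∣ ≡ k →
                  Admissible σ x t → stat R π ℕ.+ bit (R x y) ≡ stat R σ ℕ.+ 1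
  stat-displace R separated valid {x} x∈ ∣x∣≡k admissible =
    cancel (stat R π) (stat R σ) (bit (R y (at π ∣ y ∣))) (bit (R x y))
      (≡.trans (stat-balance R valid x∈ ∣x∣≡k)
               (cong (stat R σ ℕ.+_) (new-comparisons R separated valid x∈ ∣x∣≡k admissible)))
    where
    cancel : ∀ a b p q → a ℕ.+ p ℕ.+ q ≡ b ℕ.+ (1 ℕ.+ p) → a ℕ.+ q ≡ b ℕ.+ 1
    cancel a b p q eq = ℕP.+-cancelʳ-≡ p (a ℕ.+ q) (b ℕ.+ 1)
      (≡.trans (swap-last a q p) (≡.trans eq (sym (ℕP.+-assoc b 1 p))))
      where
      swap-last : ∀ a b c → a ℕ.+ b ℕ.+ c ≡ a ℕ.+ c ℕ.+ b
      swap-last = ℕ-Solver.solve-∀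

append-valid : ∀ {n σ} → SignedDerangement n σ → SignedDerangement (suc n) (extend n σ append)
append-valid {n} {σ} (signedDerangement len inRange absUnique fixedPointFree) = signedDerangement
  (≡.trans (↭-length (∷ʳ-↭ σ w)) (cong suc len))
  (All-resp-↭ (↭-sym (∷ʳ-↭ σ w)) (bounds (s≤s z≤n) ℕP.≤-refl ∷ All.map InRange-widen inRange))
  (unique-resp-↭ (PermProp.map⁺ ∣_∣ (↭-sym (∷ʳ-↭ σ w))) (above-range inRange ∷ absUnique))
  (noFixed-∷ʳ⁺ σ w fixedPointFree (λ ()))
  where
  w : ℤ
  w = - (+ suc n)

extend-valid : ∀ {n σ c} → SignedDerangement n σ → c ∈ extensions σ → SignedDerangement (suc n) (extend n σ c)
extend-valid valid (here refl) = append-valid valid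
extend-valid {n} {σ} valid (there c∈)
  with x , x∈ , c∈options ← ∈-concatMap-∃ (options σ) σ c∈
  with s , t , refl , _ ← ∈-options⁻ σ x c∈options
  with us , y , vs , refl , k≡∣x∣ ← splitAtEntry valid x∈
  = subst (SignedDerangement (suc n)) (sym (extend-displace {x} (sym k≡∣x∣))) (valid-π valid)
  where open Displacement n us y vs s t (SignedDerangement.length≡ valid)

-- The inverse of a displacement: ±(n+1) marks the displaced position k, and π(n+1) = +k
-- happens exactly when the moved entry σ(k) = -k was negated.
undisplace : ℕ → List ℤ → ℤ → List ℤ × Extension
undisplace n ρ u = σ , displace (entryWithAbs k σ) (isPositive (at ρ k)) t
  where
  k : ℕ
  t : Bool
  σ : List ℤ
  k = positionOfAbs (suc n) ρ
  t = not (does (u ℤP.≟ + k))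
  σ = setAt ρ k (if t then u else - (+ k))

undisplace-displace : ∀ n us {y} vs s t {x} → All (λ z → ∣ z ∣ ≢ suc n) us → y ≢ + suc (length us) →
                      (t ≡ false → y ≡ - (+ suc (length us))) →
                      entryWithAbs (suc (length us)) (us ++ y ∷ vs) ≡ x →
                      undisplace n (us ++ signed s (+ suc n) ∷ vs) (signed t y) ≡ (us ++ y ∷ vs , displace x s t)
undisplace-displace n us {y} vs s true us-small y≢k _ entry
  rewrite positionOfAbs-mid (suc n) us (signed s (+ suc n)) vs us-small (∣signed∣ s (+ suc n))
        | dec-false (y ℤP.≟ + suc (length us)) y≢k
        | at-mid us (signed s (+ suc n)) vs | isPositive-signed n s
        | setAt-mid us (signed s (+ suc n)) vs y | entry
  = refl
undisplace-displace n us vs s false us-small _ negated entry with refl ← negated refl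
  rewrite positionOfAbs-mid (suc n) us (signed s (+ suc n)) vs us-small (∣signed∣ s (+ suc n))
        | dec-true (- - (+ suc (length us)) ℤP.≟ + suc (length us)) (ℤP.neg-involutive _)
        | at-mid us (signed s (+ suc n)) vs | isPositive-signed n s
        | setAt-mid us (signed s (+ suc n)) vs (- (+ suc (length us))) | entry
  = refl

module _ {n σ x} (valid : SignedDerangement n σ) (x∈ : x ∈ σ) where

  open SignedDerangement valid

  displaced-inRange : InRange n (at σ ∣ x ∣)
  displaced-inRange with us , y , vs , refl , k≡∣x∣ ← splitAtEntry valid x∈
    = subst (InRange n) (≡.trans (sym (at-mid us y vs)) (cong (at (us ++ y ∷ vs)) k≡∣x∣))
            (All.lookup inRange (∈-++⁺ʳ us (here refl)))

  bottom≢displaced : ∀ t → - (+ suc n) ≢ signed t (at σ ∣ x ∣)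
  bottom≢displaced t eq = ℕP.>⇒≢ (s≤s (InRange.abs≤ displaced-inRange)) (≡.trans (cong ∣_∣ eq) (∣signed∣ t _))

  undisplace-extend : ∀ s t → Admissible σ x t →
                      undisplace n (setAt σ ∣ x ∣ (signed s (+ suc n))) (signed t (at σ ∣ x ∣)) ≡
                      (σ , displace x s t)
  undisplace-extend s t admissible with us , y , vs , refl , k≡∣x∣ ← splitAtEntry valid x∈
    rewrite sym k≡∣x∣ | setAt-mid us y vs (signed s (+ suc n)) | at-mid us y vs
    = undisplace-displace n us vs s t us-small y≢k (negated admissible)
        (subst (λ m → entryWithAbs m (us ++ y ∷ vs) ≡ x) (sym k≡∣x∣) (entryWithAbs-unique _ absUnique x∈))
    where
    us-small : All (λ z → ∣ z ∣ ≢ suc n) us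
    us-small = All.map (λ z-inRange eq → ℕP.>⇒≢ (s≤s (InRange.abs≤ z-inRange)) (sym eq)) (AllP.++⁻ˡ us inRange)
    y≢k : y ≢ + suc (length us)
    y≢k = noFixed-mid⁻ us y vs fixedPointFree
    negated : t ≡ true ⊎ y ≡ x → t ≡ false → y ≡ - (+ suc (length us))
    negated (inj₁ t≡true) t≡false with () ← ≡.trans (sym t≡true) t≡false
    negated (inj₂ y≡x)    _       = abs-neg (≡.trans (cong ∣_∣ y≡x) (sym k≡∣x∣)) y≢k

extend-injective : ∀ {n σ σ′ c c′} → SignedDerangement n σ → SignedDerangement n σ′ →
                   c ∈ extensions σ → c′ ∈ extensions σ′ → extend n σ c ≡ extend n σ′ c′ →
                   (σ , c) ≡ (σ′ , c′)
extend-injective {n} {σ} {σ′} valid valid′ c∈ c′∈ eq with ∈-extensions⁻ σ c∈ | ∈-extensions⁻ σ′ c′∈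
... | inj₁ refl | inj₁ refl = cong (_, append) (∷ʳ-injectiveˡ σ σ′ eq)
... | inj₁ refl | inj₂ (x′ , s′ , t′ , refl , x′∈ , _) =
  ⊥-elim (bottom≢displaced valid′ x′∈ t′ (∷ʳ-injectiveʳ σ _ eq))
... | inj₂ (x , s , t , refl , x∈ , _) | inj₁ refl =
  ⊥-elim (bottom≢displaced valid x∈ t (sym (∷ʳ-injectiveʳ _ σ′ eq)))
... | inj₂ (x , s , t , refl , x∈ , admissible) | inj₂ (x′ , s′ , t′ , refl , x′∈ , admissible′) =
  let front≡ , back≡ = ∷ʳ-injective _ _ eq
  in ≡.trans (sym (undisplace-extend valid x∈ s t admissible))
       (≡.trans (cong₂ (undisplace n) front≡ back≡) (undisplace-extend valid′ x′∈ s′ t′ admissible′))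

restrict-append : ∀ {n ρ} → SignedDerangement (suc n) (extend n ρ append) → SignedDerangement n ρ
restrict-append {n} {ρ} (signedDerangement len inRange absUnique fixedPointFree) = signedDerangement
  (ℕP.suc-injective (≡.trans (sym (↭-length (∷ʳ-↭ ρ w))) len))
  (InRange-narrow-all (All.tail w∷ρ-inRange) (AllPairs.head w∷ρ-unique))
  (AllPairs.tail w∷ρ-unique)
  (proj₁ (noFixed-∷ʳ⁻ ρ w fixedPointFree))
  where
  w : ℤ
  w = - (+ suc n)
  w∷ρ-inRange : All (InRange (suc n)) (w ∷ ρ)
  w∷ρ-inRange = All-resp-↭ (∷ʳ-↭ ρ w) inRange
  w∷ρ-unique : Unique (suc n ∷ map ∣_∣ ρ)
  w∷ρ-unique = unique-resp-↭ (PermProp.map⁺ ∣_∣ (∷ʳ-↭ ρ w)) absUnique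

unflip : ∀ u k → ∃ λ t → ∃ λ y → signed t y ≡ u × y ≢ + suc k × (t ≡ false → y ≡ - (+ suc k))
unflip u k with u ℤP.≟ + suc k
... | yes refl = false , - (+ suc k) , refl , (λ ()) , λ _ → refl
... | no  u≢k  = true , u , refl , u≢k , λ ()

admissible-if : ∀ {σ x} t → (t ≡ false → at σ ∣ x ∣ ≡ x) → Admissible σ x t
admissible-if true  _     = inj₁ refl
admissible-if false fixed = inj₂ (fixed refl)

Preimage : ℕ → List ℤ → Set
Preimage n π = ∃ λ σ → ∃ λ c → SignedDerangement n σ × c ∈ extensions σ × extend n σ c ≡ π

displace-preimage : ∀ {n} us e vs t y → SignedDerangement (suc n) ((us ++ e ∷ vs) ∷ʳ signed t y) →
                    ∣ e ∣ ≡ suc n → y ≢ + suc (length us) → (t ≡ false → y ≡ - (+ suc (length us))) →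
                    Preimage n ((us ++ e ∷ vs) ∷ʳ signed t y)
displace-preimage {n} us e vs t y valid ∣e∣≡ y≢k negated =
  let x , x∈ , k≡∣x∣ = abs-onto σ-valid (s≤s z≤n) k≤n
  in σ , displace x s t , σ-valid ,
     there (∈-concatMap-intro (options σ) x∈ (∈-options⁺ σ x s t (admissible x∈ k≡∣x∣))) ,
     ≡.trans (extend-displace {x} (sym k≡∣x∣)) (sym π≡)
  where
  s : Bool
  s = isPositive e
  len : length (us ++ y ∷ vs) ≡ n
  len = ≡.trans (length-mid us y e vs)
          (ℕP.suc-injective (≡.trans (sym (↭-length (∷ʳ-↭ (us ++ e ∷ vs) (signed t y))))
                                     (SignedDerangement.length≡ valid)))
  open Displacement n us y vs s t len
  π≡ : (us ++ e ∷ vs) ∷ʳ signed t y ≡ π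
  π≡ = cong (λ e′ → (us ++ e′ ∷ vs) ∷ʳ signed t y) (sym (signed-isPositive e ∣e∣≡))
  σ-valid : SignedDerangement n σ
  σ-valid = valid-σ (subst (SignedDerangement (suc n)) π≡ valid) y≢k
  y∈ : y ∈ σ
  y∈ = ∈-++⁺ʳ us (here refl)
  admissible : ∀ {x} → x ∈ σ → k ≡ ∣ x ∣ → Admissible σ x t
  admissible {x} x∈ k≡∣x∣ = admissible-if {σ} {x} t λ t≡false →
    ≡.trans (cong (at σ) (sym k≡∣x∣))
      (≡.trans at-σ-k (abs-injective-on (SignedDerangement.absUnique σ-valid) y∈ x∈
                                        (≡.trans (cong ∣_∣ (negated t≡false)) k≡∣x∣)))

top-in-front : ∀ {n ρ u} → SignedDerangement (suc n) (ρ ∷ʳ u) → u ≢ - (+ suc n) →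
               ∃ λ e → e ∈ ρ × suc n ≡ ∣ e ∣
top-in-front {n} {ρ} {u} valid u≢bottom
  with e , e∈ , n+1≡∣e∣ ← abs-onto valid (s≤s z≤n) ℕP.≤-refl | ∈-++⁻ ρ e∈
... | inj₁ e∈ρ        = e , e∈ρ , n+1≡∣e∣
... | inj₂ (here refl) with abs-top u (sym n+1≡∣e∣)
...   | inj₂ u≡bottom = ⊥-elim (u≢bottom u≡bottom)
...   | inj₁ u≡top    =
  ⊥-elim (proj₂ (noFixed-∷ʳ⁻ ρ u fixedPointFree) (≡.trans u≡top (cong (λ m → + suc m) (sym ρ-length))))
  where
  open SignedDerangement valid
  ρ-length : length ρ ≡ n
  ρ-length = ℕP.suc-injective (≡.trans (sym (↭-length (∷ʳ-↭ ρ u))) length≡)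

extend-surjective : ∀ {n π} → SignedDerangement (suc n) π → Preimage n π
extend-surjective {n} {π} valid with initLast π
... | [] with () ← SignedDerangement.length≡ valid
... | ρ ∷ʳ′ u with u ℤP.≟ - (+ suc n)
...   | yes refl = ρ , append , restrict-append valid , here refl , refl
...   | no u≢bottom
  with e , e∈ρ , n+1≡∣e∣ ← top-in-front valid u≢bottom
  with us , vs , refl ← ∈-∃++ e∈ρ
  with t , y , refl , y≢k , negated ← unflip u (length us)
  = displace-preimage us e vs t y valid (sym n+1≡∣e∣) y≢k negated

extendAll : ℕ → List (List ℤ) → List (List ℤ)
extendAll n = concatMap (λ σ → map (extend n σ) (extensions σ))

DBn-suc-↭ : ∀ n → DBn (suc n) ↭ extendAll n (DBn n)
DBn-suc-↭ n = unique-⇔⇒↭ (DBn-unique (suc n)) extendAll-unique (mk⇔ to from)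
  where
  valid : ∀ m {σ} → σ ∈ DBn m → SignedDerangement m σ
  valid m = Equivalence.to (∈-DBn⇔ m)
  extendAll-unique : Unique (extendAll n (DBn n))
  extendAll-unique = concatMap-unique _ (DBn-unique n)
    (λ σ∈ → map-unique-on _ (extensions-unique (valid n σ∈))
              λ c∈ c′∈ eq → cong proj₂ (extend-injective (valid n σ∈) (valid n σ∈) c∈ c′∈ eq))
    same-origin
    where
    same-origin : ∀ {σ σ′ π} → σ ∈ DBn n → σ′ ∈ DBn n →
                  π ∈ map (extend n σ) (extensions σ) → π ∈ map (extend n σ′) (extensions σ′) → σ ≡ σ′
    same-origin σ∈ σ′∈ π∈ π∈′
      with c , c∈ , refl ← ∈-map⁻ _ π∈
      with c′ , c′∈ , eq ← ∈-map⁻ _ π∈′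
      = cong proj₁ (extend-injective (valid n σ∈) (valid n σ′∈) c∈ c′∈ eq)
  to : ∀ {π} → π ∈ DBn (suc n) → π ∈ extendAll n (DBn n)
  to π∈ with σ , c , σ-valid , c∈ , refl ← extend-surjective {n} (valid (suc n) π∈) =
    ∈-concatMap-intro _ (Equivalence.from (∈-DBn⇔ n) σ-valid) (∈-map⁺ _ c∈)
  from : ∀ {π} → π ∈ extendAll n (DBn n) → π ∈ DBn (suc n)
  from π∈ with σ , σ∈ , π∈′ ← ∈-concatMap-∃ _ (DBn n) π∈ with c , c∈ , refl ← ∈-map⁻ _ π∈′ =
    Equivalence.from (∈-DBn⇔ (suc n)) (extend-valid (valid n σ∈) c∈)

-- Counting by statistics

δ : ℕ → ℕ → ℤ → ℤ → ℤ
δ W A (+ a) (+ b) = + bit (does (W ℕ.≟ a) ∧ does (A ℕ.≟ b))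
δ W A _     _     = + 0

δ-shiftʳ : ∀ W A i j → δ W (suc A) i j ≡ δ W A i (j - + 1)
δ-shiftʳ W A (+ a)    (+ zero)    = cong (+_ ∘ bit) (∧-zeroʳ (does (W ℕ.≟ a)))
δ-shiftʳ W A (+ a)    (+ suc b)   = refl
δ-shiftʳ W A (+ a)    -[1+ _ ]    = refl
δ-shiftʳ W A -[1+ _ ] _           = refl

δ-shiftˡ : ∀ W A i j → δ (suc W) A i j ≡ δ W A (i - + 1) j
δ-shiftˡ W A (+ zero)  (+ b)    = refl
δ-shiftˡ W A (+ zero)  -[1+ _ ] = refl
δ-shiftˡ W A (+ suc a) (+ b)    = refl
δ-shiftˡ W A (+ suc a) -[1+ _ ] = refl
δ-shiftˡ W A -[1+ _ ]  _        = refl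

δ-scaleˡ : ∀ W A i j → i * δ W A i j ≡ + W * δ W A i j
δ-scaleˡ W A (+ a) (+ b) with W ℕ.≡ᵇ a in eq
... | true  rewrite ℕP.≡ᵇ⇒≡ W a (subst T (sym eq) _) = refl
... | false = ≡.trans (ℤP.*-zeroʳ (+ a)) (sym (ℤP.*-zeroʳ (+ W)))
δ-scaleˡ W A (+ a)    -[1+ _ ] = ≡.trans (ℤP.*-zeroʳ (+ a)) (sym (ℤP.*-zeroʳ (+ W)))
δ-scaleˡ W A -[1+ m ] j        = ≡.trans (ℤP.*-zeroʳ -[1+ m ]) (sym (ℤP.*-zeroʳ (+ W)))

δ-scaleʳ : ∀ W A i j → j * δ W A i j ≡ + A * δ W A i j
δ-scaleʳ W A (+ a) (+ b) with A ℕ.≡ᵇ b in eq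
... | true  rewrite ℕP.≡ᵇ⇒≡ A b (subst T (sym eq) _) = refl
... | false rewrite ∧-zeroʳ (W ℕ.≡ᵇ a) = ≡.trans (ℤP.*-zeroʳ (+ b)) (sym (ℤP.*-zeroʳ (+ A)))
δ-scaleʳ W A (+ a)    -[1+ m ] = ≡.trans (ℤP.*-zeroʳ -[1+ m ]) (sym (ℤP.*-zeroʳ (+ A)))
δ-scaleʳ W A -[1+ m ] j        = ≡.trans (ℤP.*-zeroʳ j) (sym (ℤP.*-zeroʳ (+ A)))

data Comparison : Bool → Bool → Bool → Set where
  below : Comparison true  false false
  above : Comparison false true  false
  equal : Comparison false false true

compare : ∀ x y → Comparison (x <ᵇ y) (x >ᵇ y) (does (y ℤP.≟ x))
compare x y with x ℤP.<? y | y ℤP.<? x | y ℤP.≟ x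
... | yes _   | no _    | no _    = below
... | no _    | yes _   | no _    = above
... | no _    | no _    | yes _   = equal
... | yes x<y | yes y<x | _       = ⊥-elim (ℤP.<-asym x<y y<x)
... | yes x<y | no _    | yes refl = ⊥-elim (ℤP.<-irrefl refl x<y)
... | no _    | yes y<x | yes refl = ⊥-elim (ℤP.<-irrefl refl y<x)
... | no x≮y  | no y≮x  | no y≢x  = ⊥-elim (y≢x (ℤP.≤-antisym (ℤP.≮⇒≥ x≮y) (ℤP.≮⇒≥ y≮x)))

comparison-bits : ∀ {p q r} → Comparison p q r → bit p ℕ.+ bit q ℕ.+ bit r ≡ 1
comparison-bits below = refl
comparison-bits above = refl
comparison-bits equal = refl

count-comparisons : ∀ {A : Set} (p q r : A → Bool) xs → (∀ x → Comparison (p x) (q x) (r x)) →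
                    count p xs ℕ.+ count q xs ℕ.+ count r xs ≡ length xs
count-comparisons p q r []       _   = refl
count-comparisons p q r (x ∷ xs) cmp =
  ≡.trans (lemma (bit (p x)) (bit (q x)) (bit (r x)) (count p xs) (count q xs) (count r xs))
          (cong₂ ℕ._+_ (comparison-bits (cmp x)) (count-comparisons p q r xs cmp))
  where
  lemma : ∀ a b c d e f → a ℕ.+ d ℕ.+ (b ℕ.+ e) ℕ.+ (c ℕ.+ f) ≡ a ℕ.+ b ℕ.+ c ℕ.+ (d ℕ.+ e ℕ.+ f)
  lemma = ℕ-Solver.solve-∀

wexc+aexc+neutral : ∀ σ → wexc σ ℕ.+ aexc σ ℕ.+ count (neutral σ) σ ≡ length σ
wexc+aexc+neutral σ = count-comparisons _ _ (neutral σ) σ (λ x → compare x (at σ ∣ x ∣))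

succUnless : Bool → ℕ → ℕ
succUnless true  m = m
succUnless false m = suc m

succUnless-+bit : ∀ p {a b} → a ℕ.+ bit p ≡ b ℕ.+ 1 → a ≡ succUnless p b
succUnless-+bit true  {a} {b} eq = ℕP.+-cancelʳ-≡ 1 a b eq
succUnless-+bit false {a} {b} eq = ≡.trans (sym (ℕP.+-identityʳ a)) (≡.trans eq (ℕP.+-comm b 1))

comparison-sum : ∀ {p q r} → Comparison p q r → ∀ W A i j →
  + (if r then 4 else 2) * δ (succUnless p W) (succUnless q A) i j ≡
    + bit p * (+ 2 * δ W (suc A) i j) + + bit q * (+ 2 * δ (suc W) A i j) + + bit r * (+ 4 * δ (suc W) (suc A) i j)
comparison-sum below W A i j = lemma (δ W (suc A) i j) (δ (suc W) A i j) (δ (suc W) (suc A) i j)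
  where
  lemma : ∀ a b c → + 2 * a ≡ + 1 * (+ 2 * a) + + 0 * (+ 2 * b) + + 0 * (+ 4 * c)
  lemma = solve-∀
comparison-sum above W A i j = lemma (δ W (suc A) i j) (δ (suc W) A i j) (δ (suc W) (suc A) i j)
  where
  lemma : ∀ a b c → + 2 * b ≡ + 0 * (+ 2 * a) + + 1 * (+ 2 * b) + + 0 * (+ 4 * c)
  lemma = solve-∀
comparison-sum equal W A i j = lemma (δ W (suc A) i j) (δ (suc W) A i j) (δ (suc W) (suc A) i j)
  where
  lemma : ∀ a b c → + 4 * c ≡ + 0 * (+ 2 * a) + + 0 * (+ 2 * b) + + 1 * (+ 4 * c)
  lemma = solve-∀

module _ {n σ x} (valid : SignedDerangement n σ) (x∈ : x ∈ σ) where

  private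
    y : ℤ
    y = at σ ∣ x ∣

  option-stats : ∀ {c} → c ∈ options σ x →
                 wexc (extend n σ c) ≡ succUnless (x <ᵇ y) (wexc σ) ×
                 aexc (extend n σ c) ≡ succUnless (x >ᵇ y) (aexc σ)
  option-stats c∈
    with s , t , refl , admissible ← ∈-options⁻ σ x c∈
    with us , y′ , vs , refl , k≡∣x∣ ← splitAtEntry valid x∈
    = after (<ᵇ-separated n) , after (>ᵇ-separated n)
    where
    open Displacement n us y′ vs s t (SignedDerangement.length≡ valid) using (π; extend-displace; stat-displace; at-σ-k)
    at-x : at (us ++ y′ ∷ vs) ∣ x ∣ ≡ y′
    at-x = ≡.trans (cong (at (us ++ y′ ∷ vs)) (sym k≡∣x∣)) at-σ-k
    after : ∀ {R} → SeparatedBy n R →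
            stat R (extend n (us ++ y′ ∷ vs) (displace x s t)) ≡
            succUnless (R x (at (us ++ y′ ∷ vs) ∣ x ∣)) (stat R (us ++ y′ ∷ vs))
    after {R} separated rewrite extend-displace {x} (sym k≡∣x∣) =
      subst (λ z → stat R π ≡ succUnless (R x z) (stat R (us ++ y′ ∷ vs))) (sym at-x)
        (succUnless-+bit (R x y′) (stat-displace R separated valid x∈ (sym k≡∣x∣) admissible))

  options-sum : ∀ i j →
    ∑[ c ∈ options σ x ] δ (wexc (extend n σ c)) (aexc (extend n σ c)) i j ≡
      + bit (x <ᵇ y) * (+ 2 * δ (wexc σ) (suc (aexc σ)) i j) + + bit (x >ᵇ y) * (+ 2 * δ (suc (wexc σ)) (aexc σ) i j)
      + + bit (neutral σ x) * (+ 4 * δ (suc (wexc σ)) (suc (aexc σ)) i j)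
  options-sum i j = begin
    ∑[ c ∈ options σ x ] δ (wexc (extend n σ c)) (aexc (extend n σ c)) i j
      ≡⟨ ∑-cong (options σ x) (λ c∈ → let w≡ , a≡ = option-stats c∈ in cong₂ (λ W A → δ W A i j) w≡ a≡) ⟩
    ∑[ _ ∈ options σ x ] δ (succUnless (x <ᵇ y) (wexc σ)) (succUnless (x >ᵇ y) (aexc σ)) i j
      ≡⟨ ∑-const (options σ x) _ ⟩
    + length (options σ x) * δ (succUnless (x <ᵇ y) (wexc σ)) (succUnless (x >ᵇ y) (aexc σ)) i j
      ≡⟨ cong (λ l → + l * δ (succUnless (x <ᵇ y) (wexc σ)) (succUnless (x >ᵇ y) (aexc σ)) i j) (length-options σ x) ⟩
    + (if neutral σ x then 4 else 2) * δ (succUnless (x <ᵇ y) (wexc σ)) (succUnless (x >ᵇ y) (aexc σ)) i j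
      ≡⟨ comparison-sum (compare x y) (wexc σ) (aexc σ) i j ⟩
    + bit (x <ᵇ y) * (+ 2 * δ (wexc σ) (suc (aexc σ)) i j) + + bit (x >ᵇ y) * (+ 2 * δ (suc (wexc σ)) (aexc σ) i j)
      + + bit (neutral σ x) * (+ 4 * δ (suc (wexc σ)) (suc (aexc σ)) i j) ∎
    where open ≡.≡-Reasoning

stat-append : ∀ {n σ} R → (∀ a → R a a ≡ false) → SignedDerangement n σ → stat R (extend n σ append) ≡ stat R σ
stat-append {n} {σ} R irreflexive (signedDerangement len inRange _ _) = begin
  count Pπ (σ ∷ʳ w)          ≡⟨ count-∷ʳ Pπ σ w ⟩
  count Pπ σ ℕ.+ bit (Pπ w)  ≡⟨ cong₂ (λ c b → c ℕ.+ bit b) (count-cong σ agree) last ⟩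
  count Pσ σ ℕ.+ 0           ≡⟨ ℕP.+-identityʳ _ ⟩
  count Pσ σ                 ∎
  where
  open ≡.≡-Reasoning
  w : ℤ
  w = - (+ suc n)
  Pπ Pσ : ℤ → Bool
  Pπ e = R e (at (σ ∷ʳ w) ∣ e ∣)
  Pσ e = R e (at σ ∣ e ∣)
  agree : ∀ {e} → e ∈ σ → Pπ e ≡ Pσ e
  agree e∈ = cong (R _) (at-∷ʳ σ w _ (subst (_ ℕ.≤_) (sym len) (InRange.abs≤ (All.lookup inRange e∈))))
  last : Pπ w ≡ false
  last = ≡.trans (cong (R w) (subst (λ l → at (σ ∷ʳ w) (suc l) ≡ w) len (at-last σ w))) (irreflexive w)

extensions-sum : ∀ {n σ} → SignedDerangement n σ → ∀ i j →
  ∑[ c ∈ extensions σ ] δ (wexc (extend n σ c)) (aexc (extend n σ c)) i j ≡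
    δ (wexc σ) (aexc σ) i j + + wexc σ * (+ 2 * δ (wexc σ) (suc (aexc σ)) i j)
    + + aexc σ * (+ 2 * δ (suc (wexc σ)) (aexc σ) i j)
    + + count (neutral σ) σ * (+ 4 * δ (suc (wexc σ)) (suc (aexc σ)) i j)
extensions-sum {n} {σ} valid i j = begin
  δ (wexc (extend n σ append)) (aexc (extend n σ append)) i j + ∑ (concatMap (options σ) σ) f
    ≡⟨ cong₂ _+_ (cong₂ (λ W A → δ W A i j) (stat-append _<ᵇ_ <ᵇ-irrefl valid) (stat-append _>ᵇ_ <ᵇ-irrefl valid))
                 (∑-concatMap (options σ) σ f) ⟩
  δ W A i j + ∑[ x ∈ σ ] ∑ (options σ x) f
    ≡⟨ cong (λ s → δ W A i j + s) (∑-cong σ (λ x∈ → options-sum valid x∈ i j)) ⟩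
  δ W A i j + ∑[ x ∈ σ ] (+ bit (lt x) * K₁ + + bit (gt x) * K₂ + + bit (neutral σ x) * K₃)
    ≡⟨ cong (λ s → δ W A i j + s) (∑-count₃ lt gt (neutral σ) σ K₁ K₂ K₃) ⟩
  δ W A i j + (+ W * K₁ + + A * K₂ + + F * K₃)
    ≡⟨ regroup (δ W A i j) (+ W * K₁) (+ A * K₂) (+ F * K₃) ⟩
  δ W A i j + + W * K₁ + + A * K₂ + + F * K₃ ∎
  where
  open ≡.≡-Reasoning
  lt gt : ℤ → Bool
  lt x = x <ᵇ at σ ∣ x ∣
  gt x = x >ᵇ at σ ∣ x ∣
  W A F : ℕ
  K₁ K₂ K₃ : ℤ
  W = wexc σ
  A = aexc σ
  F = count (neutral σ) σ
  K₁ = + 2 * δ W (suc A) i j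
  K₂ = + 2 * δ (suc W) A i j
  K₃ = + 4 * δ (suc W) (suc A) i j
  f : Extension → ℤ
  f c = δ (wexc (extend n σ c)) (aexc (extend n σ c)) i j
  regroup : ∀ a b c e → a + (b + c + e) ≡ a + b + c + e
  regroup = solve-∀

δ-recurrence : ∀ W A F i j →
  δ W A i j + + W * (+ 2 * δ W (suc A) i j) + + A * (+ 2 * δ (suc W) A i j) + + F * (+ 4 * δ (suc W) (suc A) i j) ≡
    δ W A i j + + 2 * i * δ W A i (j - + 1) + + 2 * j * δ W A (i - + 1) j
    + + 4 * (+ (W ℕ.+ A ℕ.+ F) - i - j + + 2) * δ W A (i - + 1) (j - + 1)
δ-recurrence W A F i j = cong₂ _+_ (cong₂ _+_ (cong (λ s → δ W A i j + s) weak) anti) neutral-term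
  where
  open ≡.≡-Reasoning
  rearrange : ∀ c e → c * (+ 2 * e) ≡ + 2 * (c * e)
  rearrange = solve-∀
  count-neutral : ∀ w a f e → f * (+ 4 * e) ≡ + 4 * ((w + a + f) * e - (+ 1 + w) * e - (+ 1 + a) * e + + 2 * e)
  count-neutral = solve-∀
  distribute : ∀ c i j e → + 4 * (c * e - i * e - j * e + + 2 * e) ≡ + 4 * (c - i - j + + 2) * e
  distribute = solve-∀
  weak : + W * (+ 2 * δ W (suc A) i j) ≡ + 2 * i * δ W A i (j - + 1)
  weak = begin
    + W * (+ 2 * δ W (suc A) i j)     ≡⟨ cong (λ e → + W * (+ 2 * e)) (δ-shiftʳ W A i j) ⟩
    + W * (+ 2 * δ W A i (j - + 1))   ≡⟨ rearrange (+ W) (δ W A i (j - + 1)) ⟩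
    + 2 * (+ W * δ W A i (j - + 1))   ≡⟨ cong (+ 2 *_) (δ-scaleˡ W A i (j - + 1)) ⟨
    + 2 * (i * δ W A i (j - + 1))     ≡⟨ ℤP.*-assoc (+ 2) i _ ⟨
    + 2 * i * δ W A i (j - + 1)       ∎
  anti : + A * (+ 2 * δ (suc W) A i j) ≡ + 2 * j * δ W A (i - + 1) j
  anti = begin
    + A * (+ 2 * δ (suc W) A i j)     ≡⟨ cong (λ e → + A * (+ 2 * e)) (δ-shiftˡ W A i j) ⟩
    + A * (+ 2 * δ W A (i - + 1) j)   ≡⟨ rearrange (+ A) (δ W A (i - + 1) j) ⟩
    + 2 * (+ A * δ W A (i - + 1) j)   ≡⟨ cong (+ 2 *_) (δ-scaleʳ W A (i - + 1) j) ⟨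
    + 2 * (j * δ W A (i - + 1) j)     ≡⟨ ℤP.*-assoc (+ 2) j _ ⟨
    + 2 * j * δ W A (i - + 1) j       ∎
  D : ℤ
  D = δ (suc W) (suc A) i j
  neutral-term : + F * (+ 4 * D) ≡ + 4 * (+ (W ℕ.+ A ℕ.+ F) - i - j + + 2) * δ W A (i - + 1) (j - + 1)
  neutral-term = begin
    + F * (+ 4 * D)
      ≡⟨ count-neutral (+ W) (+ A) (+ F) D ⟩
    + 4 * (+ (W ℕ.+ A ℕ.+ F) * D - + suc W * D - + suc A * D + + 2 * D)
      ≡⟨ cong₂ (λ a b → + 4 * (+ (W ℕ.+ A ℕ.+ F) * D - a - b + + 2 * D))
               (δ-scaleˡ (suc W) (suc A) i j) (δ-scaleʳ (suc W) (suc A) i j) ⟨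
    + 4 * (+ (W ℕ.+ A ℕ.+ F) * D - i * D - j * D + + 2 * D)
      ≡⟨ distribute (+ (W ℕ.+ A ℕ.+ F)) i j D ⟩
    + 4 * (+ (W ℕ.+ A ℕ.+ F) - i - j + + 2) * D
      ≡⟨ cong (+ 4 * (+ (W ℕ.+ A ℕ.+ F) - i - j + + 2) *_)
              (≡.trans (δ-shiftˡ W (suc A) i j) (δ-shiftʳ W A (i - + 1) j)) ⟩
    + 4 * (+ (W ℕ.+ A ℕ.+ F) - i - j + + 2) * δ W A (i - + 1) (j - + 1) ∎

d-as-∑ : ∀ n i j → d n i j ≡ ∑[ w ∈ DBn n ] δ (wexc w) (aexc w) i j
d-as-∑ n (+ a)    (+ b)    = count-as-∑ _ (DBn n)
d-as-∑ n (+ a)    -[1+ _ ] = sym (∑-zero (DBn n))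
d-as-∑ n -[1+ _ ] j        = sym (∑-zero (DBn n))

extensions-recurrence : ∀ {n σ} → SignedDerangement n σ → ∀ i j →
  ∑[ c ∈ extensions σ ] δ (wexc (extend n σ c)) (aexc (extend n σ c)) i j ≡
    δ (wexc σ) (aexc σ) i j + + 2 * i * δ (wexc σ) (aexc σ) i (j - + 1) + + 2 * j * δ (wexc σ) (aexc σ) (i - + 1) j
    + + 4 * (+ n - i - j + + 2) * δ (wexc σ) (aexc σ) (i - + 1) (j - + 1)
extensions-recurrence {n} {σ} valid i j =
  ≡.trans (extensions-sum valid i j)
    (≡.trans (δ-recurrence W A (count (neutral σ) σ) i j)
      (cong (λ m → δ W A i j + + 2 * i * δ W A i (j - + 1) + + 2 * j * δ W A (i - + 1) j
                   + + 4 * (+ m - i - j + + 2) * δ W A (i - + 1) (j - + 1))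
            (≡.trans (wexc+aexc+neutral σ) (SignedDerangement.length≡ valid))))
  where
  W A : ℕ
  W = wexc σ
  A = aexc σ

recurrence : ∀ n i j →
  d (suc n) i j ≡ d n i j + + 2 * i * d n i (j - + 1) + + 2 * j * d n (i - + 1) j
                  + + 4 * (+ n - i - j + + 2) * d n (i - + 1) (j - + 1)
recurrence n i j = begin
  d (suc n) i j                                       ≡⟨ d-as-∑ (suc n) i j ⟩
  ∑ (DBn (suc n)) (δ-stats i j)                       ≡⟨ ∑-↭ (δ-stats i j) (DBn-suc-↭ n) ⟩
  ∑ (extendAll n (DBn n)) (δ-stats i j)               ≡⟨ ∑-concatMap _ (DBn n) (δ-stats i j) ⟩
  ∑[ σ ∈ DBn n ] ∑ (map (extend n σ) (extensions σ)) (δ-stats i j)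
    ≡⟨ ∑-cong (DBn n) (λ {σ} σ∈ → ≡.trans (∑-map (extend n σ) (extensions σ) (δ-stats i j))
                                           (extensions-recurrence (Equivalence.to (∈-DBn⇔ n) σ∈) i j)) ⟩
  ∑[ σ ∈ DBn n ] (δ-stats i j σ + c₁ * δ-stats i (j - + 1) σ + c₂ * δ-stats (i - + 1) j σ
                  + c₃ * δ-stats (i - + 1) (j - + 1) σ)
    ≡⟨ ∑-linear₄ (DBn n) (δ-stats i j) c₁ (δ-stats i (j - + 1)) c₂ (δ-stats (i - + 1) j)
                 c₃ (δ-stats (i - + 1) (j - + 1)) ⟩
  ∑ (DBn n) (δ-stats i j) + c₁ * ∑ (DBn n) (δ-stats i (j - + 1))
    + c₂ * ∑ (DBn n) (δ-stats (i - + 1) j) + c₃ * ∑ (DBn n) (δ-stats (i - + 1) (j - + 1))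
    ≡⟨ cong₂ _+_ (cong₂ _+_ (cong₂ _+_ (d-as-∑ n i j) (cong (c₁ *_) (d-as-∑ n i (j - + 1))))
                            (cong (c₂ *_) (d-as-∑ n (i - + 1) j)))
                 (cong (c₃ *_) (d-as-∑ n (i - + 1) (j - + 1))) ⟨
  d n i j + c₁ * d n i (j - + 1) + c₂ * d n (i - + 1) j + c₃ * d n (i - + 1) (j - + 1) ∎
  where
  open ≡.≡-Reasoning
  δ-stats : ℤ → ℤ → List ℤ → ℤ
  δ-stats i j w = δ (wexc w) (aexc w) i j
  c₁ c₂ c₃ : ℤ
  c₁ = + 2 * i
  c₂ = + 2 * j
  c₃ = + 4 * (+ n - i - j + + 2)

d-1-vanishes : ∀ i j → i ≢ + 0 ⊎ j ≢ + 0 → d 1 i j ≡ + 0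
d-1-vanishes (+ zero)  (+ zero)  (inj₁ i≢0) = ⊥-elim (i≢0 refl)
d-1-vanishes (+ zero)  (+ zero)  (inj₂ j≢0) = ⊥-elim (j≢0 refl)
d-1-vanishes (+ zero)  (+ suc _) _          = refl
d-1-vanishes (+ suc _) (+ _)     _          = refl
d-1-vanishes (+ _)     -[1+ _ ]  _          = refl
d-1-vanishes -[1+ _ ]  _         _          = refl

mainTheorem8 :
    ((n : ℕ) (i j : ℤ) →
      d (suc n) i j ≡ d n i j + + 2 * i * d n i (j - + 1) + + 2 * j * d n (i - + 1) j
                      + + 4 * (+ n - i - j + + 2) * d n (i - + 1) (j - + 1))
    × (d 1 (+ 0) (+ 0) ≡ + 1)
    × ((i j : ℤ) → (i ≢ + 0 ⊎ j ≢ + 0) → d 1 i j ≡ + 0)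
mainTheorem8 = recurrence , refl , d-1-vanishes
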